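{- In the construction described in the context, let $i^*,j^*\in[r]$, let $\pi'$ be an $(i^*,j^*)$-canonical elimination order of $G'$, and let $\pi$ be an elimination order for $G_{i^*,j^*}$ that eliminates all vertices of $B_{i^*,j^*}$ before any vertex of $A_{i^*,j^*}$. If $\pi'$ and $\pi$ agree on $B_{i^*,j^*}$, then $c_{G'}(\pi')=3rn+\frac n2-n+c_{G_{i^*,j^*}}(\pi)$.
   Context: Elimination: eliminating $v$ removes $v$ and adds all missing edges between its neighbors. An elimination order is a permutation of the vertices, eliminated one by one; the cost of eliminating a vertex is the size of its closed neighborhood at that moment, and the cost $c_G(\pi)$ of an order $\pi$ on $G$ is the maximum over all vertices. Construction. Let $r\ge1$, let $n$ be a positive even integer and $k$ a positive integer with $k<n/2$. For each $i,j\in[r]$ let $G_{i,j}$ be a cobipartite graph with partite sets $A_{i,j}=\{a^1_{i,j},\dots,a^n_{i,j}\}$ and $B_{i,j}=\{b^1_{i,j},\dots,b^n_{i,j}\}$ (both cliques), such that $A_{i,j}$ has a perfect matching into $B_{i,j}$. The graph $G'$ has vertices $\hat a^p_i$, $\hat b^p_i$, $c^p_i$, $d^p_i$ for $i\in[r]$, $p\in[n]$, and $x^p_i$ for $i\in[r]$, $p\in[n/2]$. Write $A'_i=\{\hat a^p_i\}_p$, $B'_i=\{\hat b^p_i\}_p$, $C'_i=\{c^p_i\}_p$, $D'_i=\{d^p_i\}_p$, $X'_i=\{x^p_i\}_p$. Edges: $A':=\bigcup_i(A'_i\cup C'_i)$ is a clique; $B':=\bigcup_i(B'_i\cup D'_i\cup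 X'_i)$ is a clique; for $i,j\in[r]$, $p,q\in[n]$, $\hat a^p_i\hat b^q_j$ is an edge iff $a^p_{i,j}b^q_{i,j}\in E(G_{i,j})$; every vertex of $C'_i$ is adjacent to all of $B'_i$; every vertex of $D'_i$ is adjacent to all of $\bigcup_{j}A'_j$ and to all of $C'_i$; every vertex of $X'_i$ is adjacent to all of $A'_i$; no other edges. An elimination order $\pi'$ of $G'$ is $(i^*,j^*)$-canonical if it eliminates: first, for all $i\in[r]\setminus\{i^*\}$, the sets $X'_i$, one whole set at a time; then the vertices of $B'_{j^*}$, followed by $D'_{j^*}$, followed by $X'_{i^*}$; then, alternatingly, a set $B'_i$ followed by $D'_i$, until all of $\bigcup_i(B'_i\cup D'_i)$ is eliminated; finally all of $\bigcup_i(A'_i\cup C'_i)$ in arbitrary order. The orders $\pi'$ and $\pi$ agree on $B_{i^*,j^*}$ if, identifying $b^q_{i^*,j^*}$ with $\hat b^q_{j^*}$ for $q\in[n]$, both orders eliminate the vertices of $B_{i^*,j^*}$ in the same relative order. -}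

module Defs where

open import Data.Bool using (Bool; true; false; _∧_; _∨_; not; if_then_else_)
open import Data.Nat using (ℕ; zero; suc; _+_; _*_; _⊔_; _/_)
open import Data.Fin using (Fin)
open import Data.Fin.Properties using () renaming (_≟_ to _≟F_)
open import Data.Maybe using (Maybe; just; nothing)
open import Data.List using (List; []; _∷_; _++_; map; concat; concatMap; allFin; filterᵇ; length; mapMaybe)
open import Data.List.Membership.Propositional using (_∈_)
open import Data.List.Relation.Binary.Permutation.Propositional using (_↭_)
open import Data.List.Relation.Binary.Pointwise using (Pointwise)
open import Data.Product using (Σ; ∃₂; _×_; _,_)
open import Relation.Binary.PropositionalEquality using (_≡_; refl)
open import Relation.Binary.Definitions using (DecidableEquality)
open import Relation.Nullary using (yes; no)
open import Relation.Nullary.Decidable using (⌊_⌋; map′)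

-- Finite simple graphs (vertex type with decidable equality, a list
-- enumerating the vertices (each once), and a symmetric irreflexive
-- Boolean adjacency relation).

record FinGraph : Set₁ where
  field
    V        : Set
    _≟_      : DecidableEquality V
    vertices : List V
    adj      : V → V → Bool

module Elimination (G : FinGraph) where
  open FinGraph G

  -- current graph during the elimination process: the vertices still
  -- present, and the (filled) adjacency relation
  record State : Set where
    field
      alive : V → Bool
      edge  : V → V → Bool
  open State

  initial : State
  initial = record { alive = λ _ → true ; edge = adj }

  closedNbhdSize : State → V → ℕ
  closedNbhdSize s v =
    suc (length (filterᵇ (λ y → alive s y ∧ edge s v y ∧ not ⌊ y ≟ v ⌋) vertices))

  eliminate : State → V → State
  eliminate s v = record
    { alive = λ y → alive s y ∧ not ⌊ y ≟ v ⌋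
    ; edge  = λ x y → edge s x y ∨ (edge s x v ∧ edge s v y)
    }

  costFrom : State → List V → ℕ
  costFrom s []       = 0
  costFrom s (v ∷ vs) = closedNbhdSize s v ⊔ costFrom (eliminate s v) vs

EliminationOrder : (G : FinGraph) → List (FinGraph.V G) → Set
EliminationOrder G π = π ↭ FinGraph.vertices G

cost : (G : FinGraph) → List (FinGraph.V G) → ℕ
cost G π = Elimination.costFrom G (Elimination.initial G) π

Before : {A : Set} → List A → A → A → Set
Before π u w = ∃₂ λ xs ys → π ≡ xs ++ u ∷ ys × w ∈ ys

-- The cobipartite graphs G_{i,j}.  The cross edges are given by
-- M : Fin n → Fin n → Bool  (a^p b^q is an edge iff M p q ≡ true);
-- A and B are cliques.

data CBV (n : ℕ) : Set where
  a : Fin n → CBV n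
  b : Fin n → CBV n

_≟CB_ : {n : ℕ} → DecidableEquality (CBV n)
a p ≟CB a q = map′ (λ { refl → refl }) (λ { refl → refl }) (p ≟F q)
a p ≟CB b q = no (λ ())
b p ≟CB a q = no (λ ())
b p ≟CB b q = map′ (λ { refl → refl }) (λ { refl → refl }) (p ≟F q)

cobipartite : (n : ℕ) → (Fin n → Fin n → Bool) → FinGraph
cobipartite n M = record
  { V        = CBV n
  ; _≟_      = _≟CB_
  ; vertices = map a (allFin n) ++ map b (allFin n)
  ; adj      = adjCB
  }
  where
  adjCB : CBV n → CBV n → Bool
  adjCB (a p) (a q) = not ⌊ p ≟F q ⌋
  adjCB (b p) (b q) = not ⌊ p ≟F q ⌋
  adjCB (a p) (b q) = M p q
  adjCB (b q) (a p) = M p q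

HasPerfectMatching : (n : ℕ) → (Fin n → Fin n → Bool) → Set
HasPerfectMatching n M =
  Σ (Fin n → Fin n) λ σ →
    ((p q : Fin n) → σ p ≡ σ q → p ≡ q) × ((p : Fin n) → M p (σ p) ≡ true)

data V' (r n : ℕ) : Set where
  â  : Fin r → Fin n → V' r n
  b̂  : Fin r → Fin n → V' r n
  c  : Fin r → Fin n → V' r n
  d  : Fin r → Fin n → V' r n
  x  : Fin r → Fin (n / 2) → V' r n

module _ {r n : ℕ} where
  private
    pairDec : {m : ℕ} → DecidableEquality (Fin r × Fin m)
    pairDec (i , p) (j , q) with i ≟F j | p ≟F q
    ... | yes refl | yes refl = yes refl
    ... | no ne    | _        = no (λ { refl → ne refl })
    ... | yes _    | no ne    = no (λ { refl → ne refl })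

  _≟V'_ : DecidableEquality (V' r n)
  â i p ≟V' â j q = map′ (λ { refl → refl }) (λ { refl → refl }) (pairDec (i , p) (j , q))
  b̂ i p ≟V' b̂ j q = map′ (λ { refl → refl }) (λ { refl → refl }) (pairDec (i , p) (j , q))
  c i p ≟V' c j q = map′ (λ { refl → refl }) (λ { refl → refl }) (pairDec (i , p) (j , q))
  d i p ≟V' d j q = map′ (λ { refl → refl }) (λ { refl → refl }) (pairDec (i , p) (j , q))
  x i p ≟V' x j q = map′ (λ { refl → refl }) (λ { refl → refl }) (pairDec (i , p) (j , q))
  â _ _ ≟V' b̂ _ _ = no (λ ())
  â _ _ ≟V' c _ _ = no (λ ())
  â _ _ ≟V' d _ _ = no (λ ())
  â _ _ ≟V' x _ _ = no (λ ())
  b̂ _ _ ≟V' â _ _ = no (λ ())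
  b̂ _ _ ≟V' c _ _ = no (λ ())
  b̂ _ _ ≟V' d _ _ = no (λ ())
  b̂ _ _ ≟V' x _ _ = no (λ ())
  c _ _ ≟V' â _ _ = no (λ ())
  c _ _ ≟V' b̂ _ _ = no (λ ())
  c _ _ ≟V' d _ _ = no (λ ())
  c _ _ ≟V' x _ _ = no (λ ())
  d _ _ ≟V' â _ _ = no (λ ())
  d _ _ ≟V' b̂ _ _ = no (λ ())
  d _ _ ≟V' c _ _ = no (λ ())
  d _ _ ≟V' x _ _ = no (λ ())
  x _ _ ≟V' â _ _ = no (λ ())
  x _ _ ≟V' b̂ _ _ = no (λ ())
  x _ _ ≟V' c _ _ = no (λ ())
  x _ _ ≟V' d _ _ = no (λ ())

  A'set B'set C'set D'set X'set : Fin r → List (V' r n)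
  A'set i = map (â i) (allFin n)
  B'set i = map (b̂ i) (allFin n)
  C'set i = map (c i) (allFin n)
  D'set i = map (d i) (allFin n)
  X'set i = map (x i) (allFin (n / 2))

  ACset : List (V' r n)
  ACset = concatMap (λ i → A'set i ++ C'set i) (allFin r)

  verticesG' : List (V' r n)
  verticesG' = concatMap (λ i → A'set i ++ B'set i ++ C'set i ++ D'set i ++ X'set i) (allFin r)

G' : (r n : ℕ) → (Fin r → Fin r → Fin n → Fin n → Bool) → FinGraph
G' r n M = record
  { V        = V' r n
  ; _≟_      = _≟V'_
  ; vertices = verticesG'
  ; adj      = adj'
  }
  where
  neq : V' r n → V' r n → Bool
  neq u v = not ⌊ u ≟V' v ⌋
  same : Fin r → Fin r → Bool
  same i j = ⌊ i ≟F j ⌋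
  adj' : V' r n → V' r n → Bool
  adj' u@(â _ _) v@(â _ _) = neq u v
  adj' (â _ _) (c _ _)     = true
  adj' (c _ _) (â _ _)     = true
  adj' u@(c _ _) v@(c _ _) = neq u v
  adj' u@(b̂ _ _) v@(b̂ _ _) = neq u v
  adj' (b̂ _ _) (d _ _)     = true
  adj' (b̂ _ _) (x _ _)     = true
  adj' (d _ _) (b̂ _ _)     = true
  adj' u@(d _ _) v@(d _ _) = neq u v
  adj' (d _ _) (x _ _)     = true
  adj' (x _ _) (b̂ _ _)     = true
  adj' (x _ _) (d _ _)     = true
  adj' u@(x _ _) v@(x _ _) = neq u v
  -- â^p_i b̂^q_j is an edge iff a^p_{i,j} b^q_{i,j} ∈ E(G_{i,j})
  adj' (â i p) (b̂ j q)     = M i j p q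
  adj' (b̂ j q) (â i p)     = M i j p q
  adj' (c i _) (b̂ j _)     = same i j
  adj' (b̂ j _) (c i _)     = same i j
  adj' (d _ _) (â _ _)     = true
  adj' (â _ _) (d _ _)     = true
  adj' (d i _) (c j _)     = same i j
  adj' (c j _) (d i _)     = same i j
  adj' (x i _) (â j _)     = same i j
  adj' (â j _) (x i _)     = same i j
  adj' (c _ _) (x _ _)     = false
  adj' (x _ _) (c _ _)     = false

module _ {r n : ℕ} where
  others : Fin r → List (Fin r)
  others i = filterᵇ (λ j → not ⌊ j ≟F i ⌋) (allFin r)

  BDBlock : List (V' r n) → Fin r → Set
  BDBlock blk i = ∃₂ λ bb dd → blk ≡ bb ++ dd × bb ↭ B'set i × dd ↭ D'set i

  record Canonical (i* j* : Fin r) (π' : List (V' r n)) : Set where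
    field
      xIdx     : List (Fin r)
      xIdx-perm : xIdx ↭ others i*
      xBlocks  : List (List (V' r n))
      xBlocks-ok : Pointwise (λ blk i → blk ↭ X'set i) xBlocks xIdx
      bj       : List (V' r n)
      bj-ok    : bj ↭ B'set j*
      dj       : List (V' r n)
      dj-ok    : dj ↭ D'set j*
      xi       : List (V' r n)
      xi-ok    : xi ↭ X'set i*
      bdIdx    : List (Fin r)
      bdIdx-perm : bdIdx ↭ others j*
      bdBlocks : List (List (V' r n))
      bdBlocks-ok : Pointwise BDBlock bdBlocks bdIdx
      final    : List (V' r n)
      final-ok : final ↭ ACset
      shape    : π' ≡ concat xBlocks ++ bj ++ dj ++ xi ++ concat bdBlocks ++ final

-- π' and π agree on B_{i*,j*} (identifying b^q_{i*,j*} with b̂^q_{j*}).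

projB : {n : ℕ} → CBV n → Maybe (Fin n)
projB (a _) = nothing
projB (b q) = just q

projB̂ : {r n : ℕ} → Fin r → V' r n → Maybe (Fin n)
projB̂ j (b̂ i q) = if ⌊ i ≟F j ⌋ then just q else nothing
projB̂ j (â _ _) = nothing
projB̂ j (c _ _) = nothing
projB̂ j (d _ _) = nothing
projB̂ j (x _ _) = nothing

AgreeOnB : {r n : ℕ} → Fin r → List (V' r n) → List (CBV n) → Set
AgreeOnB j* π' π = mapMaybe (projB̂ j*) π' ≡ mapMaybe projB π

-- Eliminating a set S of vertices leaves the vertices outside S, two of them adjacent iff some
-- walk between them has all its inner vertices in S.  With this description every closed
-- neighbourhood met by the canonical order π′ can be counted.  While B′_{j*} is eliminated in
-- the order of π, the neighbourhood of b̂^q_{j*} mirrors that of b^q in G_{i*,j*} on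
-- A′_{i*} ∪ B′_{j*}, and in addition contains all other A′_l (through the eliminated X′_l) and
-- B′_l, and all of C′_{j*}, D′ and X′_{i*}: exactly 3rn + n/2 − n extra vertices.  Every other
-- step of π′ costs at most 3rn + n/2, while the B′_{j*} phase costs at least that much because
-- the first b eliminated in G_{i*,j*} already costs n.  Finally, the cost of π is attained on
-- B_{i*,j*}, since afterwards every a has fewer than n neighbours.

module Submission where

open import Defs
open import Data.Bool using (Bool; true; false; T; _∧_; _∨_; not; if_then_else_)
open import Data.Bool.Properties using (T-∧; T-∨)
open import Data.Empty using (⊥; ⊥-elim)
open import Data.Fin using (Fin; zero; suc; punchIn; punchOut; fromℕ<)
open import Data.Fin.Properties using (punchInᵢ≢i; punchIn-injective; punchIn-punchOut) renaming (_≟_ to _≟F_)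
open import Data.List using (List; []; _∷_; _++_; map; concat; concatMap; allFin; filterᵇ; length; tabulate; mapMaybe)
open import Data.List.Properties using (map-tabulate; length-++; filter-++; ++-identityʳ; mapMaybe-++; mapMaybe-map-retract; ∷-injectiveʳ)
open import Data.List.Membership.Propositional using (_∈_; _∉_; find; lose)
open import Data.List.Relation.Binary.Subset.Propositional using (_⊆_)
open import Data.List.Membership.Propositional.Properties using (∈-map⁺; ∈-map⁻; ∈-++⁺ˡ; ∈-++⁺ʳ; ∈-++⁻; ∈-allFin; ∈-filter⁻; ∈-filter⁺; ∈-concat⁻′)
open import Data.List.Relation.Binary.Pointwise as Pointwise using (Pointwise; []; _∷_)
open import Data.List.Relation.Unary.All using (All; []; _∷_)
import Data.List.Relation.Unary.All as All
open import Data.List.Relation.Unary.AllPairs using (_∷_)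
open import Data.List.Relation.Unary.Unique.Propositional using (Unique)
import Data.List.Relation.Unary.Unique.Propositional.Properties as Unique
open import Data.List.Relation.Binary.Permutation.Propositional using (_↭_; ↭-sym; ↭⇒↭ₛ)
open import Data.List.Relation.Binary.Permutation.Propositional.Properties using (∈-resp-↭; ++⁺)
import Data.List.Relation.Binary.Permutation.Setoid.Properties as Permutationₛ
open import Data.Maybe using (Maybe; just; nothing)
open import Data.List.Relation.Unary.Any using (Any; here; there; any?)
open import Data.Nat using (ℕ; zero; suc; _+_; _*_; _∸_; _/_; _<_; _≤_; _⊔_; z≤n; s≤s)
open import Data.Nat.Properties hiding (_≟_)
open import Algebra.Properties.CommutativeMonoid.Sum +-0-commutativeMonoid using (sum; sum-cong-≗; sum-remove; ∑-distrib-+)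
open import Data.Nat.Tactic.RingSolver using (solve-∀)
open import Data.Nat.DivMod using (m/n≤m)
open import Data.Nat.Divisibility using (_∣_)
open import Data.Product using (∃; ∃₂; _×_; _,_; proj₁; proj₂)
open import Data.Sum using (_⊎_; inj₁; inj₂; [_,_]′)
open import Data.Unit using (⊤; tt)
open import Function using (_∘_; Equivalence)
open import Relation.Nullary using (¬_; yes; no)
open import Relation.Nullary.Decidable using (⌊_⌋; T?; toWitness; fromWitness; toWitnessFalse; fromWitnessFalse)
open import Relation.Binary.PropositionalEquality

open Equivalence using (to; from)

⊔-≡-+ : ∀ {u k m} → u ⊔ k ≡ k + m → 0 < m → u ≡ k + m
⊔-≡-+ {u} {k} {m} eq 0<m with ⊔-sel u k
... | inj₁ u⊔k≡u = trans (sym u⊔k≡u) eq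
... | inj₂ u⊔k≡k = ⊥-elim (<⇒≢ 0<m (+-cancelˡ-≡ k 0 m (trans (+-identityʳ k) (trans (sym u⊔k≡k) eq))))

⊔-peak : ∀ {u m w} → u ≤ m → w ≤ m → u ⊔ (m ⊔ w) ≡ m
⊔-peak {u} {m} {w} u≤m w≤m = trans (cong (u ⊔_) (m≥n⇒m⊔n≡m w≤m)) (m≤n⇒m⊔n≡n u≤m)

shift-identity : ∀ {A B α β} k w h → A + k ≡ α + w → B + k ≡ β + w → k ≤ w + w + w + h →
                 suc (A + (B + (k + (w + h)))) ≡ (w + w + w + h ∸ k) + suc (α + β)
shift-identity {A} {B} {α} {β} k w h A+k≡ B+k≡ k≤ = +-cancelʳ-≡ k _ _ (begin
  suc (A + (B + (k + (w + h)))) + k       ≡⟨ regroup A B k w h ⟩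
  suc (A + k + (B + k) + w + h)           ≡⟨ cong₂ (λ u v → suc (u + v + w + h)) A+k≡ B+k≡ ⟩
  suc (α + w + (β + w) + w + h)           ≡⟨ regroup′ α β w h ⟩
  w + w + w + h + suc (α + β)             ≡⟨ cong (_+ suc (α + β)) (m∸n+n≡m k≤) ⟨
  (w + w + w + h ∸ k) + k + suc (α + β)   ≡⟨ +-comm-middle (w + w + w + h ∸ k) k (suc (α + β)) ⟩
  (w + w + w + h ∸ k) + suc (α + β) + k   ∎)
  where
  open ≡-Reasoning
  regroup : ∀ u v k w h → suc (u + (v + (k + (w + h)))) + k ≡ suc (u + k + (v + k) + w + h)
  regroup = solve-∀
  regroup′ : ∀ u v w h → suc (u + w + (v + w) + w + h) ≡ w + w + w + h + suc (u + v)
  regroup′ = solve-∀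
  +-comm-middle : ∀ u v w → u + v + w ≡ u + w + v
  +-comm-middle = solve-∀

sum-mono : ∀ {r} {f g : Fin r → ℕ} → (∀ l → f l ≤ g l) → sum f ≤ sum g
sum-mono {zero}  h = z≤n
sum-mono {suc r} h = +-mono-≤ (h zero) (sum-mono (h ∘ suc))

sum-const : ∀ r k → sum {r} (λ _ → k) ≡ r * k
sum-const zero    k = refl
sum-const (suc r) k = cong (k +_) (sum-const r k)

sum-≤-const : ∀ {r} {f : Fin r → ℕ} {k} → (∀ l → f l ≤ k) → sum f ≤ r * k
sum-≤-const {r} {k = k} h = ≤-trans (sum-mono h) (≤-reflexive (sum-const r k))

sum-≡-const : ∀ {r} {f : Fin r → ℕ} {k} → (∀ l → f l ≡ k) → sum f ≡ r * k
sum-≡-const {r} {k = k} h = trans (sum-cong-≗ h) (sum-const r k)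

sum-≡-0 : ∀ {r} {f : Fin r → ℕ} → (∀ l → f l ≡ 0) → sum f ≡ 0
sum-≡-0 {r} h = trans (sum-≡-const h) (*-zeroʳ r)

sum-≤-except : ∀ {r} {f : Fin r → ℕ} i {k} → (∀ l → l ≢ i → f l ≤ k) → sum f + k ≤ f i + r * k
sum-≤-except {suc r} {f} i {k} h = begin
  sum f + k                          ≡⟨ cong (_+ k) (sum-remove f) ⟩
  f i + sum (f ∘ punchIn i) + k      ≤⟨ +-monoˡ-≤ k (+-monoʳ-≤ (f i) (sum-≤-const (λ l → h _ (punchInᵢ≢i i l)))) ⟩
  f i + r * k + k                    ≡⟨ shuffle (f i) (r * k) k ⟩
  f i + suc r * k                    ∎
  where
  open ≤-Reasoning
  shuffle : ∀ u v w → u + v + w ≡ u + (w + v)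
  shuffle = solve-∀

sum-≡-except : ∀ {r} {f : Fin r → ℕ} i {k} → (∀ l → l ≢ i → f l ≡ k) → sum f + k ≡ f i + r * k
sum-≡-except {suc r} {f} i {k} h = begin
  sum f + k                          ≡⟨ cong (_+ k) (sum-remove f) ⟩
  f i + sum (f ∘ punchIn i) + k      ≡⟨ cong (λ s → f i + s + k) (sum-≡-const (λ l → h _ (punchInᵢ≢i i l))) ⟩
  f i + r * k + k                    ≡⟨ shuffle (f i) (r * k) k ⟩
  f i + suc r * k                    ∎
  where
  open ≡-Reasoning
  shuffle : ∀ u v w → u + v + w ≡ u + (w + v)
  shuffle = solve-∀

sum-single : ∀ {r} {f : Fin r → ℕ} i → (∀ l → l ≢ i → f l ≡ 0) → sum f ≡ f i
sum-single {r} {f} i h = begin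
  sum f            ≡⟨ +-identityʳ (sum f) ⟨
  sum f + 0        ≡⟨ sum-≡-except i h ⟩
  f i + r * 0      ≡⟨ cong (f i +_) (*-zeroʳ r) ⟩
  f i + 0          ≡⟨ +-identityʳ (f i) ⟩
  f i              ∎
  where open ≡-Reasoning

sum-≤-except₂ : ∀ {r} {f : Fin r → ℕ} {i j} {k} → i ≢ j → (∀ l → l ≢ i → l ≢ j → f l ≤ k) →
                sum f + (k + k) ≤ f i + f j + r * k
sum-≤-except₂ {suc r} {f} {i} {j} {k} i≢j h = begin
  sum f + (k + k)                    ≡⟨ cong (_+ (k + k)) (sum-remove f) ⟩
  f i + sum g + (k + k)              ≡⟨ shuffle (f i) (sum g) k ⟩
  f i + (sum g + k) + k              ≤⟨ +-monoˡ-≤ k (+-monoʳ-≤ (f i) (sum-≤-except j′ h′)) ⟩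
  f i + (g j′ + r * k) + k           ≡⟨ cong (λ m → f i + (f m + r * k) + k) (punchIn-punchOut i≢j) ⟩
  f i + (f j + r * k) + k            ≡⟨ shuffle′ (f i) (f j) (r * k) k ⟩
  f i + f j + suc r * k              ∎
  where
  open ≤-Reasoning
  g : Fin r → ℕ
  g = f ∘ punchIn i
  j′ = punchOut i≢j
  h′ : ∀ l → l ≢ j′ → g l ≤ k
  h′ l l≢j′ = h _ (punchInᵢ≢i i l) (λ eq → l≢j′ (punchIn-injective i l j′ (trans eq (sym (punchIn-punchOut i≢j)))))
  shuffle : ∀ u v w → u + v + (w + w) ≡ u + (v + w) + w
  shuffle = solve-∀
  shuffle′ : ∀ u v w z → u + (v + w) + z ≡ u + v + (z + w)
  shuffle′ = solve-∀

suc-sum-≤-except : ∀ {r} {f : Fin r → ℕ} i {k e} → (∀ l → l ≢ i → f l ≤ k) → suc (f i) ≤ k + e → suc (sum f) ≤ e + r * k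
suc-sum-≤-except {r} {f} i {k} {e} h fi<k+e = +-cancelˡ-≤ k _ _ (begin
  k + suc (sum f)                    ≡⟨ +-suc k (sum f) ⟩
  suc (k + sum f)                    ≡⟨ cong suc (+-comm k (sum f)) ⟩
  suc (sum f + k)                    ≤⟨ s≤s (sum-≤-except i h) ⟩
  suc (f i) + r * k                  ≤⟨ +-monoˡ-≤ (r * k) fi<k+e ⟩
  k + e + r * k                      ≡⟨ +-assoc k e (r * k) ⟩
  k + (e + r * k)                    ∎)
  where open ≤-Reasoning

suc-sum-≤-except₂ : ∀ {r} {f : Fin r → ℕ} {i j} {k e} → i ≢ j → (∀ l → l ≢ i → l ≢ j → f l ≤ k) →
                    suc (f i) + f j ≤ k + k + e → suc (sum f) ≤ e + r * k
suc-sum-≤-except₂ {r} {f} {i} {j} {k} {e} i≢j h fij≤ = +-cancelˡ-≤ (k + k) _ _ (begin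
  k + k + suc (sum f)                ≡⟨ +-comm (k + k) (suc (sum f)) ⟩
  suc (sum f + (k + k))              ≤⟨ s≤s (sum-≤-except₂ i≢j h) ⟩
  suc (f i) + f j + r * k            ≤⟨ +-monoˡ-≤ (r * k) fij≤ ⟩
  k + k + e + r * k                  ≡⟨ +-assoc (k + k) e (r * k) ⟩
  k + k + (e + r * k)                ∎)
  where open ≤-Reasoning

indicator : Bool → ℕ
indicator t = if t then 1 else 0

count : {m : ℕ} → (Fin m → Bool) → ℕ
count f = sum (indicator ∘ f)

indicator-≤1 : ∀ t → indicator t ≤ 1
indicator-≤1 true  = s≤s z≤n
indicator-≤1 false = z≤n

indicator-mono : ∀ {t u} → (T t → T u) → indicator t ≤ indicator u
indicator-mono {true}  {true}  _ = s≤s z≤n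
indicator-mono {true}  {false} h = ⊥-elim (h tt)
indicator-mono {false}         _ = z≤n

indicator-true : ∀ {t} → T t → indicator t ≡ 1
indicator-true {true} _ = refl

indicator-false : ∀ {t} → ¬ T t → indicator t ≡ 0
indicator-false {true}  h = ⊥-elim (h tt)
indicator-false {false} _ = refl

module _ {m : ℕ} where

  count-≤ : (f : Fin m → Bool) → count f ≤ m
  count-≤ f = ≤-trans (sum-≤-const (indicator-≤1 ∘ f)) (≤-reflexive (*-identityʳ m))

  count-mono : {f g : Fin m → Bool} → (∀ p → T (f p) → T (g p)) → count f ≤ count g
  count-mono h = sum-mono (indicator-mono ∘ h)

  count-none : {f : Fin m → Bool} → (∀ p → ¬ T (f p)) → count f ≡ 0
  count-none h = trans (sum-≡-const (indicator-false ∘ h)) (*-zeroʳ m)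

  count-all : {f : Fin m → Bool} → (∀ p → T (f p)) → count f ≡ m
  count-all h = trans (sum-≡-const (indicator-true ∘ h)) (*-identityʳ m)

  count-<-missing : {f : Fin m → Bool} (t : Fin m) → ¬ T (f t) → count f < m
  count-<-missing {f} t ¬ft = begin
    suc (count f)                    ≡⟨ +-comm 1 (count f) ⟩
    count f + 1                      ≤⟨ sum-≤-except t (λ p _ → indicator-≤1 (f p)) ⟩
    indicator (f t) + m * 1          ≡⟨ cong₂ _+_ (indicator-false ¬ft) (*-identityʳ m) ⟩
    m                                ∎
    where open ≤-Reasoning

  count-≥-all-but : {f : Fin m → Bool} (t : Fin m) → (∀ p → p ≢ t → T (f p)) → m ≤ suc (count f)
  count-≥-all-but {f} t h = begin
    m                                ≤⟨ m≤n+m m (indicator (f t)) ⟩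
    indicator (f t) + m              ≡⟨ cong (indicator (f t) +_) (*-identityʳ m) ⟨
    indicator (f t) + m * 1          ≡⟨ sum-≡-except t (λ p p≢t → indicator-true (h p p≢t)) ⟨
    count f + 1                      ≡⟨ +-comm (count f) 1 ⟩
    suc (count f)                    ∎
    where open ≤-Reasoning

  count-⇔ : {f g : Fin m → Bool} → (∀ p → T (f p) → T (g p)) → (∀ p → T (g p) → T (f p)) → count f ≡ count g
  count-⇔ f⇒g g⇒f = ≤-antisym (count-mono f⇒g) (count-mono g⇒f)

module _ {A : Set} (f : A → Bool) where

  length-filter-++ : ∀ xs ys → length (filterᵇ f (xs ++ ys)) ≡ length (filterᵇ f xs) + length (filterᵇ f ys)
  length-filter-++ xs ys = trans (cong length (filter-++ (T? ∘ f) xs ys)) (length-++ (filterᵇ f xs))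

  length-filter-tabulate : ∀ {m} (g : Fin m → A) → length (filterᵇ f (tabulate g)) ≡ count (f ∘ g)
  length-filter-tabulate {zero}  g = refl
  length-filter-tabulate {suc m} g with f (g zero)
  ... | true  = cong suc (length-filter-tabulate (g ∘ suc))
  ... | false = length-filter-tabulate (g ∘ suc)

  length-filter-map-allFin : ∀ {m} (g : Fin m → A) → length (filterᵇ f (map g (allFin m))) ≡ count (f ∘ g)
  length-filter-map-allFin g = trans (cong (length ∘ filterᵇ f) (map-tabulate (λ p → p) g)) (length-filter-tabulate g)

  length-filter-concatMap-allFin : ∀ {r} (h : Fin r → List A) →
    length (filterᵇ f (concatMap h (allFin r))) ≡ sum (λ l → length (filterᵇ f (h l)))
  length-filter-concatMap-allFin {r} h = trans (cong (length ∘ filterᵇ f ∘ concat) (map-tabulate (λ p → p) h)) (go r h)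
    where
    go : ∀ r (h : Fin r → List A) → length (filterᵇ f (concat (tabulate h))) ≡ sum (λ l → length (filterᵇ f (h l)))
    go zero    h = refl
    go (suc r) h = trans (length-filter-++ (h zero) _) (cong (length (filterᵇ f (h zero)) +_) (go r (h ∘ suc)))

module _ {A : Set} where

  Unique-resp-↭ : {xs ys : List A} → xs ↭ ys → Unique xs → Unique ys
  Unique-resp-↭ xs↭ys = Permutationₛ.Unique-resp-↭ (setoid A) (↭⇒↭ₛ xs↭ys)

  Before-asym : ∀ {π : List A} {u w} → Unique π → Before π u w → Before π w u → ⊥
  Before-asym un (xs , ys , refl , w∈ys) (xs′ , ys′ , eq , u∈ys′) = go xs xs′ un eq w∈ys u∈ys′
    where
    go : ∀ xs xs′ {u w ys ys′} → Unique (xs ++ u ∷ ys) → xs ++ u ∷ ys ≡ xs′ ++ w ∷ ys′ → w ∈ ys → u ∈ ys′ → ⊥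
    go []       []        (u∉ys ∷ _) refl w∈ys _     = All.lookup u∉ys w∈ys refl
    go []       (_ ∷ xs′) (u∉ys ∷ _) refl _    u∈ys′ = All.lookup u∉ys (∈-++⁺ʳ xs′ (there u∈ys′)) refl
    go (_ ∷ xs) []        (w∉ys ∷ _) refl w∈ys _     = All.lookup w∉ys (∈-++⁺ʳ xs (there w∈ys)) refl
    go (_ ∷ xs) (_ ∷ xs′) (_ ∷ un)   eq   w∈ys u∈ys′ = go xs xs′ un (∷-injectiveʳ eq) w∈ys u∈ys′

  ∈-map-allFin⁻ : ∀ {m} {κ : Fin m → A} {z} → z ∈ map κ (allFin m) → ∃ λ p → z ≡ κ p
  ∈-map-allFin⁻ {κ = κ} z∈ with ∈-map⁻ κ z∈
  ... | p , _ , z≡ = p , z≡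

  ∈-map-allFin⁺ : ∀ {m} (κ : Fin m → A) p → κ p ∈ map κ (allFin m)
  ∈-map-allFin⁺ κ p = ∈-map⁺ κ (∈-allFin p)

  ∈-segment⁻ : ∀ {m} {κ : Fin m → A} {seg z} → seg ↭ map κ (allFin m) → z ∈ seg → ∃ λ p → z ≡ κ p
  ∈-segment⁻ seg↭ z∈ = ∈-map-allFin⁻ (∈-resp-↭ seg↭ z∈)

  ∈-segment⁺ : ∀ {m} {κ : Fin m → A} {seg} → seg ↭ map κ (allFin m) → ∀ p → κ p ∈ seg
  ∈-segment⁺ {κ = κ} seg↭ p = ∈-resp-↭ (↭-sym seg↭) (∈-map-allFin⁺ κ p)

  module _ {I : Set} {F : I → List A} where

    ∈-concat-↭⁻ : ∀ {bs is} → Pointwise (λ blk i → blk ↭ F i) bs is → ∀ {z} → z ∈ concat bs → ∃ λ i → i ∈ is × z ∈ F i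
    ∈-concat-↭⁻ {blk ∷ _} (blk↭ ∷ rest) z∈ with ∈-++⁻ blk z∈
    ... | inj₁ z∈blk  = _ , here refl , ∈-resp-↭ blk↭ z∈blk
    ... | inj₂ z∈rest with ∈-concat-↭⁻ rest z∈rest
    ...   | i , i∈is , z∈Fi = i , there i∈is , z∈Fi

    ∈-concat-↭⁺ : ∀ {bs is} → Pointwise (λ blk i → blk ↭ F i) bs is → ∀ {i z} → i ∈ is → z ∈ F i → z ∈ concat bs
    ∈-concat-↭⁺ (blk↭ ∷ _) (here refl) z∈Fi = ∈-++⁺ˡ (∈-resp-↭ (↭-sym blk↭) z∈Fi)
    ∈-concat-↭⁺ {blk ∷ _} (_ ∷ rest) (there i∈is) z∈Fi = ∈-++⁺ʳ blk (∈-concat-↭⁺ rest i∈is z∈Fi)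

  map-mapMaybe-retract : ∀ {B : Set} (f : A → Maybe B) (g : B → A) xs →
    (∀ {y} → y ∈ xs → ∃ λ q → y ≡ g q × f y ≡ just q) → xs ≡ map g (mapMaybe f xs)
  map-mapMaybe-retract f g []       h = refl
  map-mapMaybe-retract f g (y ∷ xs) h with h (here refl)
  ... | q , refl , fy≡ rewrite fy≡ = cong (g q ∷_) (map-mapMaybe-retract f g xs (h ∘ there))

  mapMaybe-nothing-∈ : ∀ {B : Set} (f : A → Maybe B) xs → (∀ {y} → y ∈ xs → f y ≡ nothing) → mapMaybe f xs ≡ []
  mapMaybe-nothing-∈ f []       h = refl
  mapMaybe-nothing-∈ f (y ∷ xs) h rewrite h (here refl) = mapMaybe-nothing-∈ f xs (h ∘ there)

module EliminationProperties (G : FinGraph) where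
  open FinGraph G
  open Elimination G

  run : State → List V → State
  run s []       = s
  run s (v ∷ vs) = run (eliminate s v) vs

  run-++ : ∀ s xs ys → run s (xs ++ ys) ≡ run (run s xs) ys
  run-++ s []       ys = refl
  run-++ s (v ∷ xs) ys = run-++ (eliminate s v) xs ys

  costFrom-++ : ∀ s xs ys → costFrom s (xs ++ ys) ≡ costFrom s xs ⊔ costFrom (run s xs) ys
  costFrom-++ s []       ys = refl
  costFrom-++ s (v ∷ xs) ys = trans (cong (closedNbhdSize s v ⊔_) (costFrom-++ (eliminate s v) xs ys))
                                    (sym (⊔-assoc (closedNbhdSize s v) (costFrom (eliminate s v) xs) _))

  costFrom-≥ : ∀ s L₁ v L₂ → closedNbhdSize (run s L₁) v ≤ costFrom s (L₁ ++ v ∷ L₂)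
  costFrom-≥ s []       v L₂ = m≤m⊔n (closedNbhdSize s v) (costFrom (eliminate s v) L₂)
  costFrom-≥ s (w ∷ L₁) v L₂ = ≤-trans (costFrom-≥ (eliminate s w) L₁ v L₂) (m≤n⊔m (closedNbhdSize s w) _)

  costFrom-≤ : ∀ s L {B} → (∀ L₁ {v} → L₁ ⊆ L → v ∈ L → closedNbhdSize (run s L₁) v ≤ B) → costFrom s L ≤ B
  costFrom-≤ s []      h = z≤n
  costFrom-≤ s (v ∷ L) h = ⊔-lub (h [] (λ ()) (here refl))
    (costFrom-≤ (eliminate s v) L (λ L₁ L₁⊆L w∈L → h (v ∷ L₁) (λ { (here refl) → here refl ; (there z∈L₁) → there (L₁⊆L z∈L₁) }) (there w∈L)))

  costFrom-run-≤ : ∀ s P L {B} → (∀ L₁ {v} → L₁ ⊆ L → v ∈ L → closedNbhdSize (run s (P ++ L₁)) v ≤ B) →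
                   costFrom (run s P) L ≤ B
  costFrom-run-≤ s P L {B} h = costFrom-≤ (run s P) L (λ L₁ {v} L₁⊆L v∈L →
    subst (λ st → closedNbhdSize st v ≤ B) (run-++ s P L₁) (h L₁ L₁⊆L v∈L))

  costFrom-concat-≤ : ∀ {I : Set} {R : List V → I → Set} {P : I → Set} s {B} {bs is} →
    Pointwise R bs is → All P is →
    (∀ {pb pi} → Pointwise R pb pi → ∀ {blk i} → R blk i → P i → costFrom (run s (concat pb)) blk ≤ B) →
    costFrom s (concat bs) ≤ B
  costFrom-concat-≤ s [] [] h = z≤n
  costFrom-concat-≤ s {B} {blk ∷ bs} (rb ∷ rbs) (pi ∷ pis) h =
    subst (_≤ B) (sym (costFrom-++ s blk (concat bs)))
      (⊔-lub (h [] rb pi)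
             (costFrom-concat-≤ (run s blk) rbs pis (λ {pb} rpb {blk′} rb′ pi′ →
               subst (λ st → costFrom st blk′ ≤ B) (run-++ s blk (concat pb)) (h (rb ∷ rpb) rb′ pi′))))

  data WalkThrough (S : V → Set) (u : V) : V → Set where
    start : ∀ {y} → T (adj u y) → WalkThrough S u y
    step  : ∀ {z y} → WalkThrough S u z → S z → T (adj z y) → WalkThrough S u y

  walk-map : ∀ {S S′ : V → Set} {u y} → (∀ {z} → S z → S′ z) → WalkThrough S u y → WalkThrough S′ u y
  walk-map f (start e)     = start e
  walk-map f (step w sz e) = step (walk-map f w) (f sz) e

  walk-++ : ∀ {S u z y} → WalkThrough S u z → S z → WalkThrough S z y → WalkThrough S u y
  walk-++ w sz (start e)       = step w sz e
  walk-++ w sz (step w′ sz′ e) = step (walk-++ w sz w′) sz′ e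

  walk-split : ∀ {S v u y} → WalkThrough (λ z → z ≡ v ⊎ S z) u y →
               WalkThrough S u y ⊎ (WalkThrough S u v × WalkThrough S v y)
  walk-split (start e) = inj₁ (start e)
  walk-split (step w (inj₁ refl) e) with walk-split w
  ... | inj₁ wv       = inj₂ (wv , start e)
  ... | inj₂ (wv , _) = inj₂ (wv , start e)
  walk-split (step w (inj₂ sz) e) with walk-split w
  ... | inj₁ wz        = inj₁ (step wz sz e)
  ... | inj₂ (wv , wz) = inj₂ (wv , step wz sz e)

  walk-invariant : ∀ {S : V → Set} {u} (Q : V → Set) →
                   (∀ y → T (adj u y) → Q y) → (∀ z y → S z → Q z → T (adj z y) → Q y) →
                   ∀ {y} → WalkThrough S u y → Q y
  walk-invariant Q q₀ q₊ (start e)     = q₀ _ e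
  walk-invariant Q q₀ q₊ (step w sz e) = q₊ _ _ sz (walk-invariant Q q₀ q₊ w) e

  record IsEliminationOf (s : State) (S : V → Set) : Set where
    field
      alive⇒∉   : ∀ y → T (State.alive s y) → ¬ S y
      ∉⇒alive   : ∀ y → ¬ S y → T (State.alive s y)
      edge⇒walk : ∀ u y → T (State.edge s u y) → WalkThrough S u y
      walk⇒edge : ∀ u y → WalkThrough S u y → T (State.edge s u y)
  open IsEliminationOf

  IsEliminationOf-resp : ∀ {s S S′} → (∀ {z} → S z → S′ z) → (∀ {z} → S′ z → S z) →
                         IsEliminationOf s S → IsEliminationOf s S′
  IsEliminationOf-resp f g el = record
    { alive⇒∉   = λ y t s′ → alive⇒∉ el y t (g s′)
    ; ∉⇒alive   = λ y ∉S′ → ∉⇒alive el y (∉S′ ∘ f)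
    ; edge⇒walk = λ u y t → walk-map f (edge⇒walk el u y t)
    ; walk⇒edge = λ u y w → walk⇒edge el u y (walk-map g w)
    }

  initial-IsEliminationOf : IsEliminationOf initial (λ _ → ⊥)
  initial-IsEliminationOf = record
    { alive⇒∉   = λ _ _ ()
    ; ∉⇒alive   = λ _ _ → tt
    ; edge⇒walk = λ _ _ → start
    ; walk⇒edge = λ _ _ → unwalk
    }
    where
    unwalk : ∀ {u y} → WalkThrough (λ _ → ⊥) u y → T (adj u y)
    unwalk (start e) = e

  eliminate-IsEliminationOf : ∀ {s S} v → IsEliminationOf s S → IsEliminationOf (eliminate s v) (λ z → z ≡ v ⊎ S z)
  eliminate-IsEliminationOf {s} {S} v el = record
    { alive⇒∉   = dead
    ; ∉⇒alive   = λ y ∉S → from T-∧ (∉⇒alive el y (∉S ∘ inj₂) , fromWitnessFalse (∉S ∘ inj₁))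
    ; edge⇒walk = fill⇒walk
    ; walk⇒edge = walk⇒fill
    }
    where
    S⁺ : V → Set
    S⁺ z = z ≡ v ⊎ S z
    dead : ∀ y → T (State.alive s y ∧ not ⌊ y ≟ v ⌋) → ¬ S⁺ y
    dead y t with to (T-∧ {State.alive s y}) t
    ... | _  , y≢v = λ { (inj₁ y≡v) → toWitnessFalse y≢v y≡v ; (inj₂ sy) → alive⇒∉ el y (proj₁ (to T-∧ t)) sy }
    fill⇒walk : ∀ u y → T (State.edge s u y ∨ (State.edge s u v ∧ State.edge s v y)) → WalkThrough S⁺ u y
    fill⇒walk u y t with to (T-∨ {State.edge s u y}) t
    ... | inj₁ uy = walk-map inj₂ (edge⇒walk el u y uy)
    ... | inj₂ uvy with to (T-∧ {State.edge s u v}) uvy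
    ...   | uv , vy = walk-++ (walk-map inj₂ (edge⇒walk el u v uv)) (inj₁ refl) (walk-map inj₂ (edge⇒walk el v y vy))
    walk⇒fill : ∀ u y → WalkThrough S⁺ u y → T (State.edge s u y ∨ (State.edge s u v ∧ State.edge s v y))
    walk⇒fill u y w with walk-split w
    ... | inj₁ uy         = from (T-∨ {State.edge s u y}) (inj₁ (walk⇒edge el u y uy))
    ... | inj₂ (uv , vy)  = from (T-∨ {State.edge s u y}) (inj₂ (from T-∧ (walk⇒edge el u v uv , walk⇒edge el v y vy)))

  run-IsEliminationOf : ∀ {s S} L → IsEliminationOf s S → IsEliminationOf (run s L) (λ z → z ∈ L ⊎ S z)
  run-IsEliminationOf []      el = IsEliminationOf-resp inj₂ (λ { (inj₂ sz) → sz }) el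
  run-IsEliminationOf (v ∷ L) el =
    IsEliminationOf-resp reassoc unassoc (run-IsEliminationOf L (eliminate-IsEliminationOf v el))
    where
    reassoc : ∀ {z} → z ∈ L ⊎ (z ≡ v ⊎ _) → z ∈ v ∷ L ⊎ _
    reassoc (inj₁ z∈L)         = inj₁ (there z∈L)
    reassoc (inj₂ (inj₁ z≡v))  = inj₁ (here z≡v)
    reassoc (inj₂ (inj₂ sz))   = inj₂ sz
    unassoc : ∀ {z} → z ∈ v ∷ L ⊎ _ → z ∈ L ⊎ (z ≡ v ⊎ _)
    unassoc (inj₁ (here z≡v))  = inj₂ (inj₁ z≡v)
    unassoc (inj₁ (there z∈L)) = inj₁ z∈L
    unassoc (inj₂ sz)          = inj₂ (inj₂ sz)

  after : List V → State
  after = run initial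

  after-IsEliminationOf : ∀ L → IsEliminationOf (after L) (_∈ L)
  after-IsEliminationOf L =
    IsEliminationOf-resp (λ { (inj₁ z∈L) → z∈L ; (inj₂ ()) }) inj₁ (run-IsEliminationOf L initial-IsEliminationOf)

  isNeighbour : State → V → V → Bool
  isNeighbour s v y = State.alive s y ∧ State.edge s v y ∧ not ⌊ y ≟ v ⌋

  isNeighbour⁻ : ∀ L {v y} → T (isNeighbour (after L) v y) → y ∉ L × WalkThrough (_∈ L) v y × y ≢ v
  isNeighbour⁻ L {v} {y} t with to (T-∧ {State.alive (after L) y}) t
  ... | alive , rest with to (T-∧ {State.edge (after L) v y}) rest
  ...   | vy , y≢v = alive⇒∉ (after-IsEliminationOf L) y alive , edge⇒walk (after-IsEliminationOf L) v y vy , toWitnessFalse y≢v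

  isNeighbour⁺ : ∀ L {v y} → y ∉ L → WalkThrough (_∈ L) v y → y ≢ v → T (isNeighbour (after L) v y)
  isNeighbour⁺ L {v} {y} y∉L w y≢v =
    from T-∧ (∉⇒alive (after-IsEliminationOf L) y y∉L , from T-∧ (walk⇒edge (after-IsEliminationOf L) v y w , fromWitnessFalse y≢v))

  eliminated-¬isNeighbour : ∀ L {v y} → y ∈ L → ¬ T (isNeighbour (after L) v y)
  eliminated-¬isNeighbour L y∈L t = proj₁ (isNeighbour⁻ L t) y∈L

  self-¬isNeighbour : ∀ L {v} → ¬ T (isNeighbour (after L) v v)
  self-¬isNeighbour L t = proj₂ (proj₂ (isNeighbour⁻ L t)) refl

  count-isNeighbour-eliminated : ∀ S {v m} {κ : Fin m → V} → (∀ p → κ p ∈ S) → count (isNeighbour (after S) v ∘ κ) ≡ 0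
  count-isNeighbour-eliminated S κ∈S = count-none (λ p → eliminated-¬isNeighbour S (κ∈S p))

  count-isNeighbour-self : ∀ S {m} (κ : Fin m → V) t → count (isNeighbour (after S) (κ t) ∘ κ) < m
  count-isNeighbour-self S κ t = count-<-missing t (self-¬isNeighbour S)

  isNeighbour-within : ∀ (Good : V → Set) S {v} →
    (∀ {y} → T (adj v y) → Good y) → (∀ {z y} → z ∈ S → T (adj z y) → Good y) →
    ∀ {y} → T (isNeighbour (after S) v y) → Good y
  isNeighbour-within Good S good₀ good₊ t =
    walk-invariant Good (λ _ → good₀) (λ _ _ z∈S _ → good₊ z∈S) (proj₁ (proj₂ (isNeighbour⁻ S t)))

  costFrom-after-++ : ∀ P L R → costFrom (after P) (L ++ R) ≡ costFrom (after P) L ⊔ costFrom (after (P ++ L)) R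
  costFrom-after-++ P L R =
    trans (costFrom-++ (after P) L R) (cong (λ st → costFrom (after P) L ⊔ costFrom st R) (sym (run-++ initial P L)))

module _ (G₁ G₂ : FinGraph) {I : Set} (g₁ : I → FinGraph.V G₁) (g₂ : I → FinGraph.V G₂) (K : ℕ) where
  private
    module E₁ = Elimination G₁
    module E₂ = Elimination G₂
    module P₁ = EliminationProperties G₁
    module P₂ = EliminationProperties G₂

  costFrom-shift : ∀ s₁ s₂ qs →
    (∀ qa q qb → qs ≡ qa ++ q ∷ qb →
       E₁.closedNbhdSize (P₁.run s₁ (map g₁ qa)) (g₁ q) ≡ K + E₂.closedNbhdSize (P₂.run s₂ (map g₂ qa)) (g₂ q)) →
    E₁.costFrom s₁ (map g₁ qs) ⊔ K ≡ K + E₂.costFrom s₂ (map g₂ qs)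
  costFrom-shift s₁ s₂ []       h = sym (+-identityʳ K)
  costFrom-shift s₁ s₂ (q ∷ qs) h = begin
    (c₁ ⊔ R₁) ⊔ K    ≡⟨ ⊔-assoc c₁ R₁ K ⟩
    c₁ ⊔ (R₁ ⊔ K)    ≡⟨ cong₂ _⊔_ (h [] q qs refl) rest ⟩
    (K + c₂) ⊔ (K + R₂) ≡⟨ +-distribˡ-⊔ K c₂ R₂ ⟨
    K + (c₂ ⊔ R₂)    ∎
    where
    open ≡-Reasoning
    c₁ = E₁.closedNbhdSize s₁ (g₁ q)
    c₂ = E₂.closedNbhdSize s₂ (g₂ q)
    R₁ = E₁.costFrom (E₁.eliminate s₁ (g₁ q)) (map g₁ qs)
    R₂ = E₂.costFrom (E₂.eliminate s₂ (g₂ q)) (map g₂ qs)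
    rest : R₁ ⊔ K ≡ K + R₂
    rest = costFrom-shift (E₁.eliminate s₁ (g₁ q)) (E₂.eliminate s₂ (g₂ q)) qs
             (λ qa q′ qb eq → h (q ∷ qa) q′ qb (cong (q ∷_) eq))

module CobipartiteElimination (n : ℕ) (M : Fin n → Fin n → Bool) where
  G : FinGraph
  G = cobipartite n M
  open Elimination G public
  open EliminationProperties G public

  closedNbhdSize-count : ∀ s v →
    closedNbhdSize s v ≡ suc (count (isNeighbour s v ∘ a) + count (isNeighbour s v ∘ b))
  closedNbhdSize-count s v = cong suc (trans (length-filter-++ f (map a (allFin n)) _)
    (cong₂ _+_ (length-filter-map-allFin f a) (length-filter-map-allFin f b)))
    where f = isNeighbour s v

  b∉ : ∀ {qs : List (Fin n)} {q} → q ∉ qs → b q ∉ map b qs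
  b∉ q∉qs b∈ with ∈-map⁻ b b∈
  ... | _ , q′∈qs , refl = q∉qs q′∈qs

  a∉ : ∀ {qs : List (Fin n)} {p} → a p ∉ map b qs
  a∉ a∈ with ∈-map⁻ b a∈
  ... | _ , _ , ()

  b-adj-b : ∀ {q q′} → q′ ≢ q → T (FinGraph.adj G (b q) (b q′))
  b-adj-b q′≢q = fromWitnessFalse (q′≢q ∘ sym)

  module _ (qs : List (Fin n)) (q : Fin n) where

    b-isNeighbour-b⁻ : ∀ {q′} → T (isNeighbour (after (map b qs)) (b q) (b q′)) → q′ ∉ qs × q′ ≢ q
    b-isNeighbour-b⁻ t with isNeighbour⁻ (map b qs) t
    ... | b∉qs , _ , b≢ = b∉qs ∘ ∈-map⁺ b , b≢ ∘ cong b

    b-isNeighbour-b⁺ : ∀ {q′} → q′ ∉ qs → q′ ≢ q → T (isNeighbour (after (map b qs)) (b q) (b q′))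
    b-isNeighbour-b⁺ q′∉qs q′≢q = isNeighbour⁺ (map b qs) (b∉ q′∉qs) (start (b-adj-b q′≢q)) λ { refl → q′≢q refl }

    b-isNeighbour-a⁻ : ∀ {p} → T (isNeighbour (after (map b qs)) (b q) (a p)) → Any (T ∘ M p) (q ∷ qs)
    b-isNeighbour-a⁻ = isNeighbour-within Reach (map b qs) reach₀ reach₊
      where
      Reach : CBV n → Set
      Reach (a p′) = Any (T ∘ M p′) (q ∷ qs)
      Reach (b _)  = ⊤
      reach₀ : ∀ {y} → T (FinGraph.adj G (b q) y) → Reach y
      reach₀ {a _} e = here e
      reach₀ {b _} _ = tt
      reach₊ : ∀ {z y} → z ∈ map b qs → T (FinGraph.adj G z y) → Reach y
      reach₊ {y = b _} _  _ = tt
      reach₊ {y = a _} z∈ e with ∈-map⁻ b z∈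
      ... | q′ , q′∈qs , refl = there (lose q′∈qs e)

    b-isNeighbour-a⁺ : ∀ {p} → Any (T ∘ M p) (q ∷ qs) → T (isNeighbour (after (map b qs)) (b q) (a p))
    b-isNeighbour-a⁺ {p} adj = isNeighbour⁺ (map b qs) a∉ (walk adj) (λ ())
      where
      walk : Any (T ∘ M p) (q ∷ qs) → WalkThrough (_∈ map b qs) (b q) (a p)
      walk (here e) = start e
      walk (there adj′) with find adj′
      ... | q′ , q′∈qs , e with q′ ≟F q
      ...   | yes refl = start e
      ...   | no q′≢q  = step (start (b-adj-b q′≢q)) (∈-map⁺ b q′∈qs) e

  first-b-≥ : ∀ q → n ≤ closedNbhdSize initial (b q)
  first-b-≥ q = begin
    n                                                         ≤⟨ count-≥-all-but q (λ q′ → b-isNeighbour-b⁺ [] q (λ ())) ⟩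
    suc (count (isNeighbour initial (b q) ∘ b))               ≤⟨ s≤s (m≤n+m _ _) ⟩
    suc (count (isNeighbour initial (b q) ∘ a) + count (isNeighbour initial (b q) ∘ b)) ≡⟨ closedNbhdSize-count initial (b q) ⟨
    closedNbhdSize initial (b q)                              ∎
    where open ≤-Reasoning

  a-after-all-b-≤ : ∀ L p → (∀ q → b q ∈ L) → closedNbhdSize (after L) (a p) ≤ n
  a-after-all-b-≤ L p all-b = begin
    closedNbhdSize (after L) (a p)                                       ≡⟨ closedNbhdSize-count (after L) (a p) ⟩
    suc (count (isNeighbour (after L) (a p) ∘ a) + count (isNeighbour (after L) (a p) ∘ b))
      ≡⟨ cong (λ k → suc (count (isNeighbour (after L) (a p) ∘ a) + k)) (count-none (λ q → eliminated-¬isNeighbour L (all-b q))) ⟩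
    suc (count (isNeighbour (after L) (a p) ∘ a) + 0)                    ≡⟨ cong suc (+-identityʳ _) ⟩
    suc (count (isNeighbour (after L) (a p) ∘ a))                        ≤⟨ count-<-missing p (self-¬isNeighbour L) ⟩
    n                                                                    ∎
    where open ≤-Reasoning

  a-injective : ∀ {p q} → CBV.a {n} p ≡ a q → p ≡ q
  a-injective refl = refl

  b-injective : ∀ {p q} → CBV.b {n} p ≡ b q → p ≡ q
  b-injective refl = refl

  vertices-Unique : Unique (FinGraph.vertices G)
  vertices-Unique = Unique.++⁺ (Unique.map⁺ a-injective (Unique.allFin⁺ n)) (Unique.map⁺ b-injective (Unique.allFin⁺ n)) disjoint
    where
    disjoint : ∀ {v} → ¬ (v ∈ map a (allFin n) × v ∈ map b (allFin n))
    disjoint (a∈ , b∈) with ∈-map⁻ a a∈ | ∈-map⁻ b b∈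
    ... | _ , _ , refl | _ , _ , ()

  spanB : List (CBV n) → List (Fin n) × List (CBV n)
  spanB (b q ∷ π) = q ∷ proj₁ (spanB π) , proj₂ (spanB π)
  spanB π         = [] , π

  spanB-++ : ∀ π → π ≡ map b (proj₁ (spanB π)) ++ proj₂ (spanB π)
  spanB-++ []        = refl
  spanB-++ (a p ∷ π) = refl
  spanB-++ (b q ∷ π) = cong (b q ∷_) (spanB-++ π)

  spanB-rest : ∀ π → proj₂ (spanB π) ≡ [] ⊎ ∃₂ λ p t → proj₂ (spanB π) ≡ a p ∷ t
  spanB-rest []        = inj₁ refl
  spanB-rest (a p ∷ π) = inj₂ (p , π , refl)
  spanB-rest (b q ∷ π) = spanB-rest π

  record BFirstSplit (π : List (CBV n)) : Set where
    field
      bs      : List (Fin n)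
      rest    : List (CBV n)
      π≡      : π ≡ map b bs ++ rest
      rest-a  : ∀ {y} → y ∈ rest → ∃ λ p → y ≡ a p
      bs-all  : ∀ q → q ∈ bs

  bFirstSplit : ∀ {π} → EliminationOrder G π → (∀ p q → Before π (b q) (a p)) → BFirstSplit π
  bFirstSplit {π} π↭ b-before-a = record
    { bs = bs ; rest = rest ; π≡ = π≡ ; rest-a = rest-a ; bs-all = bs-all }
    where
    bs = proj₁ (spanB π)
    rest = proj₂ (spanB π)
    π≡ = spanB-++ π
    rest-a : ∀ {y} → y ∈ rest → ∃ λ p → y ≡ a p
    rest-a {y} y∈ with spanB-rest π
    ... | inj₁ rest≡[] with subst (y ∈_) rest≡[] y∈
    ...   | ()
    rest-a {y} y∈ | inj₂ (p , t , rest≡) = in-a∷t (subst (y ∈_) rest≡ y∈)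
      where
      in-a∷t : ∀ {y} → y ∈ a p ∷ t → ∃ λ p′ → y ≡ a p′
      in-a∷t         (here refl) = p , refl
      in-a∷t {a p′} (there _)   = p′ , refl
      in-a∷t {b q′} (there b∈t) = ⊥-elim (Before-asym (Unique-resp-↭ (↭-sym π↭) vertices-Unique)
                                        (b-before-a p q′) (map b bs , t , trans π≡ (cong (map b bs ++_) rest≡) , b∈t))
    bs-all : ∀ q → q ∈ bs
    bs-all q with ∈-++⁻ (map b bs) (subst (b q ∈_) π≡ (∈-resp-↭ (↭-sym π↭) (∈-++⁺ʳ (map a (allFin n)) (∈-map⁺ b (∈-allFin q)))))
    ... | inj₁ b∈bs with ∈-map⁻ b b∈bs
    ...   | _ , q∈bs , refl = q∈bs
    bs-all q | inj₂ b∈rest with rest-a b∈rest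
    ...   | _ , ()

  module _ {π : List (CBV n)} (split : BFirstSplit π) where
    open BFirstSplit split

    mapMaybe-projB : mapMaybe projB π ≡ bs
    mapMaybe-projB = begin
      mapMaybe projB π                                      ≡⟨ cong (mapMaybe projB) π≡ ⟩
      mapMaybe projB (map b bs ++ rest)                     ≡⟨ mapMaybe-++ projB (map b bs) rest ⟩
      mapMaybe projB (map b bs) ++ mapMaybe projB rest      ≡⟨ cong₂ _++_ (mapMaybe-map-retract (λ _ → refl) bs)
                                                                         (mapMaybe-nothing-∈ projB rest projB-a) ⟩
      bs ++ []                                              ≡⟨ ++-identityʳ bs ⟩
      bs                                                    ∎
      where
      open ≡-Reasoning
      projB-a : ∀ {y} → y ∈ rest → projB y ≡ nothing
      projB-a y∈ with rest-a y∈
      ... | _ , refl = refl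

    costFrom-B-≥ : Fin n → n ≤ costFrom initial (map b bs)
    costFrom-B-≥ q₀ = first-≥ bs (bs-all q₀)
      where
      first-≥ : ∀ qs → q₀ ∈ qs → n ≤ costFrom initial (map b qs)
      first-≥ (q ∷ qs) _ = ≤-trans (first-b-≥ q) (costFrom-≥ initial [] (b q) (map b qs))

    cost-B-first : Fin n → cost G π ≡ costFrom initial (map b bs)
    cost-B-first q₀ = begin
      cost G π                                                          ≡⟨ cong (costFrom initial) π≡ ⟩
      costFrom initial (map b bs ++ rest)                               ≡⟨ costFrom-++ initial (map b bs) rest ⟩
      costFrom initial (map b bs) ⊔ costFrom (after (map b bs)) rest    ≡⟨ m≥n⇒m⊔n≡m (≤-trans A-part-≤ (costFrom-B-≥ q₀)) ⟩
      costFrom initial (map b bs)                                       ∎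
      where
      open ≡-Reasoning
      A-part-≤ : costFrom (after (map b bs)) rest ≤ n
      A-part-≤ = costFrom-run-≤ initial (map b bs) rest a-step
        where
        a-step : ∀ L₁ {v} → L₁ ⊆ rest → v ∈ rest → closedNbhdSize (after (map b bs ++ L₁)) v ≤ n
        a-step L₁ _ v∈ with rest-a v∈
        ... | p , refl = a-after-all-b-≤ (map b bs ++ L₁) p (λ q → ∈-++⁺ˡ (∈-map⁺ b (bs-all q)))

module CompositeElimination (r n : ℕ) (M : Fin r → Fin r → Fin n → Fin n → Bool) where
  H : FinGraph
  H = G' r n M
  open Elimination H public
  open EliminationProperties H public

  adjH : V' r n → V' r n → Bool
  adjH = FinGraph.adj H

  module _ (f : V' r n → Bool) where
    #â #b̂ #c #d : Fin r → ℕ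
    #â l = count (f ∘ â l)
    #b̂ l = count (f ∘ b̂ l)
    #c l = count (f ∘ c l)
    #d l = count (f ∘ d l)
    #x : Fin r → ℕ
    #x l = count (f ∘ x l)

  closedNbhdSize-count : ∀ s v → let f = isNeighbour s v in
    closedNbhdSize s v ≡ suc (sum (#â f) + (sum (#b̂ f) + (sum (#c f) + (sum (#d f) + sum (#x f)))))
  closedNbhdSize-count s v = cong suc (begin
    length (filterᵇ f verticesG')                                       ≡⟨ length-filter-concatMap-allFin f blocks ⟩
    sum (λ l → length (filterᵇ f (blocks l)))                          ≡⟨ sum-cong-≗ per-index ⟩
    sum (λ l → #â f l + (#b̂ f l + (#c f l + (#d f l + #x f l))))        ≡⟨ ∑-distrib-+ (#â f) _ ⟩
    sum (#â f) + _                                                      ≡⟨ cong (sum (#â f) +_) (∑-distrib-+ (#b̂ f) _) ⟩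
    sum (#â f) + (sum (#b̂ f) + _)                                       ≡⟨ cong (λ k → sum (#â f) + (sum (#b̂ f) + k)) (∑-distrib-+ (#c f) _) ⟩
    sum (#â f) + (sum (#b̂ f) + (sum (#c f) + _))                        ≡⟨ cong (λ k → sum (#â f) + (sum (#b̂ f) + (sum (#c f) + k))) (∑-distrib-+ (#d f) (#x f)) ⟩
    sum (#â f) + (sum (#b̂ f) + (sum (#c f) + (sum (#d f) + sum (#x f)))) ∎)
    where
    open ≡-Reasoning
    f = isNeighbour s v
    blocks : Fin r → List (V' r n)
    blocks l = A'set l ++ B'set l ++ C'set l ++ D'set l ++ X'set l
    per-index : ∀ l → length (filterᵇ f (blocks l)) ≡ #â f l + (#b̂ f l + (#c f l + (#d f l + #x f l)))
    per-index l =
      trans (length-filter-++ f (A'set l) _) (cong₂ _+_ (length-filter-map-allFin f (â l))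
      (trans (length-filter-++ f (B'set l) _) (cong₂ _+_ (length-filter-map-allFin f (b̂ l))
      (trans (length-filter-++ f (C'set l) _) (cong₂ _+_ (length-filter-map-allFin f (c l))
      (trans (length-filter-++ f (D'set l) _) (cong₂ _+_ (length-filter-map-allFin f (d l))
                                                          (length-filter-map-allFin f (x l)))))))))

  weight : (V' r n → Bool) → Fin r → ℕ
  weight f l = #â f l + (#b̂ f l + (#c f l + #d f l))

  closedNbhdSize-weight : ∀ s v → let f = isNeighbour s v in
    closedNbhdSize s v ≡ suc (sum (weight f) + sum (#x f))
  closedNbhdSize-weight s v = trans (closedNbhdSize-count s v) (cong suc (begin
    A + (B + (C + (D + X)))        ≡⟨ regroup A B C D X ⟩
    A + (B + (C + D)) + X          ≡⟨ cong (_+ X) (sym (trans (∑-distrib-+ (#â f) _) (cong (A +_)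
                                        (trans (∑-distrib-+ (#b̂ f) _) (cong (B +_) (∑-distrib-+ (#c f) (#d f))))))) ⟩
    sum (weight f) + X             ∎))
    where
    open ≡-Reasoning
    f = isNeighbour s v
    A = sum (#â f)
    B = sum (#b̂ f)
    C = sum (#c f)
    D = sum (#d f)
    X = sum (#x f)
    regroup : ∀ u v w y z → u + (v + (w + (y + z))) ≡ u + (v + (w + y)) + z
    regroup = solve-∀

  bound : ℕ
  bound = 3 * r * n + n / 2

  bound≡ : bound ≡ r * (3 * n) + n / 2
  bound≡ = reorder r n (n / 2)
    where
    reorder : ∀ r n h → 3 * r * n + h ≡ r * (3 * n) + h
    reorder = solve-∀

  n≤bound : 1 ≤ r → n ≤ bound
  n≤bound 1≤r = begin
    n                      ≤⟨ m≤m+n n (n + (n + 0)) ⟩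
    3 * n                  ≡⟨ *-identityˡ (3 * n) ⟨
    1 * (3 * n)            ≤⟨ *-monoˡ-≤ (3 * n) 1≤r ⟩
    r * (3 * n)            ≤⟨ m≤m+n (r * (3 * n)) (n / 2) ⟩
    r * (3 * n) + n / 2    ≡⟨ bound≡ ⟨
    bound                  ∎
    where open ≤-Reasoning

  three≡ : n + (n + n) ≡ 3 * n
  three≡ = cong (λ k → n + (n + k)) (sym (+-identityʳ n))

  weight-≤ : ∀ f l → #b̂ f l ≡ 0 ⊎ #c f l ≡ 0 → weight f l ≤ 3 * n
  weight-≤ f l one-empty = begin
    weight f l                   ≤⟨ +-mono-≤ (count-≤ (f ∘ â l)) (middle one-empty) ⟩
    n + (n + n)                  ≡⟨ three≡ ⟩
    3 * n                        ∎
    where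
    open ≤-Reasoning
    middle : #b̂ f l ≡ 0 ⊎ #c f l ≡ 0 → #b̂ f l + (#c f l + #d f l) ≤ n + n
    middle (inj₁ b̂0) = begin
      #b̂ f l + (#c f l + #d f l) ≡⟨ cong (_+ (#c f l + #d f l)) b̂0 ⟩
      #c f l + #d f l            ≤⟨ +-mono-≤ (count-≤ (f ∘ c l)) (count-≤ (f ∘ d l)) ⟩
      n + n                      ∎
    middle (inj₂ c0) = begin
      #b̂ f l + (#c f l + #d f l) ≡⟨ cong (λ k → #b̂ f l + (k + #d f l)) c0 ⟩
      #b̂ f l + #d f l            ≤⟨ +-mono-≤ (count-≤ (f ∘ b̂ l)) (count-≤ (f ∘ d l)) ⟩
      n + n                      ∎

  InBDX : (Fin r → Set) → V' r n → Set
  InBDX P (b̂ l _) = P l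
  InBDX P (d l _) = P l
  InBDX P (x _ _) = ⊤
  InBDX P (â _ _) = ⊥
  InBDX P (c _ _) = ⊥

  -- X′ is not adjacent to C′, and B′_l, D′_l are adjacent to C′_l only.
  c-isNeighbour-index : ∀ (P : Fin r → Set) S {v} → (∀ {z} → z ∈ S → InBDX P z) →
    (∀ l p → T (adjH v (c l p)) → P l) → ∀ {l p} → T (isNeighbour (after S) v (c l p)) → P l
  c-isNeighbour-index P S {v} S-BDX v-c = isNeighbour-within Good S {v} good₀ good₊
    where
    Good : V' r n → Set
    Good (c l _) = P l
    Good _       = ⊤
    good₀ : ∀ {y} → T (adjH v y) → Good y
    good₀ {â _ _} _ = tt
    good₀ {b̂ _ _} _ = tt
    good₀ {c l p} e = v-c l p e
    good₀ {d _ _} _ = tt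
    good₀ {x _ _} _ = tt
    good₊ : ∀ {z y} → z ∈ S → T (adjH z y) → Good y
    good₊ {y = â _ _} _ _ = tt
    good₊ {y = b̂ _ _} _ _ = tt
    good₊ {y = d _ _} _ _ = tt
    good₊ {y = x _ _} _ _ = tt
    good₊ {z} {c l _} z∈S e with z | S-BDX z∈S
    ... | b̂ l′ _ | Pl′ = subst P (sym (toWitness e)) Pl′
    ... | d l′ _ | Pl′ = subst P (toWitness e) Pl′

  module XPhase (S : List (V' r n)) (pi : List (Fin r)) (i : Fin r) (t : Fin (n / 2))
      (S-x : ∀ {z} → z ∈ S → ∃₂ λ l p → z ≡ x l p × (l ∈ pi ⊎ l ≡ i))
      (pi-done : ∀ {l} p → l ∈ pi → x l p ∈ S) where
    open ≤-Reasoning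

    f : V' r n → Bool
    f = isNeighbour (after S) (x i t)

    total : Fin r → ℕ
    total l = weight f l + #x f l

    a-index : ∀ {l p} → T (f (â l p)) → l ∈ pi ⊎ l ≡ i
    a-index = isNeighbour-within Good S good₀ good₊
      where
      Good : V' r n → Set
      Good (â l _) = l ∈ pi ⊎ l ≡ i
      Good _       = ⊤
      good₀ : ∀ {y} → T (adjH (x i t) y) → Good y
      good₀ {â _ _} e = inj₂ (sym (toWitness e))
      good₀ {b̂ _ _} _ = tt
      good₀ {c _ _} _ = tt
      good₀ {d _ _} _ = tt
      good₀ {x _ _} _ = tt
      good₊ : ∀ {z y} → z ∈ S → T (adjH z y) → Good y
      good₊ {y = b̂ _ _} _ _ = tt
      good₊ {y = c _ _} _ _ = tt
      good₊ {y = d _ _} _ _ = tt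
      good₊ {y = x _ _} _ _ = tt
      good₊ {y = â l _} z∈S e with S-x z∈S
      ... | l′ , _ , refl , l′-ok = subst (λ k → k ∈ pi ⊎ k ≡ i) (toWitness e) l′-ok

    c-none : ∀ l → #c f l ≡ 0
    c-none l = count-none {f = f ∘ c l} (λ p → c-isNeighbour-index (λ _ → ⊥) S {x i t} S-BDX (λ _ _ ()))
      where
      S-BDX : ∀ {z} → z ∈ S → InBDX (λ _ → ⊥) z
      S-BDX z∈S with S-x z∈S
      ... | _ , _ , refl , _ = tt

    total≡ : ∀ l → total l ≡ #â f l + #x f l + (#b̂ f l + #d f l)
    total≡ l = trans (cong (λ k → #â f l + (#b̂ f l + (k + #d f l)) + #x f l) (c-none l)) (regroup (#â f l) (#b̂ f l) (#d f l) (#x f l))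
      where
      regroup : ∀ u v w y → u + (v + (0 + w)) + y ≡ u + y + (v + w)
      regroup = solve-∀

    ax-≤ : ∀ l → l ≢ i → #â f l + #x f l ≤ n
    ax-≤ l l≢i with any? (l ≟F_) pi
    ... | yes l∈pi = begin
      #â f l + #x f l   ≡⟨ cong (#â f l +_) (count-isNeighbour-eliminated S (λ p → pi-done p l∈pi)) ⟩
      #â f l + 0        ≡⟨ +-identityʳ _ ⟩
      #â f l            ≤⟨ count-≤ (f ∘ â l) ⟩
      n                 ∎
    ... | no l∉pi = begin
      #â f l + #x f l   ≡⟨ cong (_+ #x f l) (count-none {f = f ∘ â l} (λ p → [ l∉pi , l≢i ]′ ∘ a-index)) ⟩
      #x f l            ≤⟨ count-≤ (f ∘ x l) ⟩
      n / 2             ≤⟨ m/n≤m n 2 ⟩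
      n                 ∎

    total-other : ∀ l → l ≢ i → total l ≤ 3 * n
    total-other l l≢i = begin
      total l                                   ≡⟨ total≡ l ⟩
      #â f l + #x f l + (#b̂ f l + #d f l)       ≤⟨ +-mono-≤ (ax-≤ l l≢i) (+-mono-≤ (count-≤ (f ∘ b̂ l)) (count-≤ (f ∘ d l))) ⟩
      n + (n + n)                               ≡⟨ three≡ ⟩
      3 * n                                     ∎

    total-self : suc (total i) ≤ 3 * n + n / 2
    total-self = begin
      suc (total i)                               ≡⟨ cong suc (total≡ i) ⟩
      suc (#â f i + #x f i) + (#b̂ f i + #d f i)   ≡⟨ cong (_+ (#b̂ f i + #d f i)) (+-suc (#â f i) (#x f i)) ⟨
      #â f i + suc (#x f i) + (#b̂ f i + #d f i)   ≤⟨ +-mono-≤ (+-mono-≤ (count-≤ (f ∘ â i)) (count-isNeighbour-self S (x i) t))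
                                                               (+-mono-≤ (count-≤ (f ∘ b̂ i)) (count-≤ (f ∘ d i))) ⟩
      n + n / 2 + (n + n)                         ≡⟨ regroup n (n / 2) ⟩
      3 * n + n / 2                               ∎
      where
      regroup : ∀ m h → m + h + (m + m) ≡ 3 * m + h
      regroup = solve-∀

    x-phase-≤ : closedNbhdSize (after S) (x i t) ≤ bound
    x-phase-≤ = begin
      closedNbhdSize (after S) (x i t)     ≡⟨ closedNbhdSize-weight (after S) (x i t) ⟩
      suc (sum (weight f) + sum (#x f))    ≡⟨ cong suc (∑-distrib-+ (weight f) (#x f)) ⟨
      suc (sum total)                      ≤⟨ suc-sum-≤-except i total-other total-self ⟩
      n / 2 + r * (3 * n)                  ≡⟨ trans (+-comm (n / 2) (r * (3 * n))) (sym bound≡) ⟩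
      bound                                ∎

  module BPhase (i* j* : Fin r) (S : List (V' r n)) (qa : List (Fin n)) (q : Fin n)
      (S-shape : ∀ {z} → z ∈ S → (∃₂ λ l p → z ≡ x l p × l ≢ i*) ⊎ (∃ λ q′ → z ≡ b̂ j* q′ × q′ ∈ qa))
      (x-done : ∀ {l} p → l ≢ i* → x l p ∈ S)
      (b-done : ∀ {q′} → q′ ∈ qa → b̂ j* q′ ∈ S) where

    module Gᵢⱼ = CobipartiteElimination n (M i* j*)

    f : V' r n → Bool
    f = isNeighbour (after S) (b̂ j* q)
    g : CBV n → Bool
    g = Gᵢⱼ.isNeighbour (Gᵢⱼ.after (map b qa)) (b q)

    ∉S : ∀ {y} → (∀ {l p} → y ≡ x l p → l ≡ i*) → (∀ {q′} → y ≡ b̂ j* q′ → q′ ∉ qa) → y ∉ S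
    ∉S not-x not-b y∈S with S-shape y∈S
    ... | inj₁ (_ , _ , y≡x , l≢i*) = l≢i* (not-x y≡x)
    ... | inj₂ (_ , y≡b̂ , q′∈qa)    = not-b y≡b̂ q′∈qa

    b̂-adj-b̂ : ∀ {l q′} → b̂ l q′ ≢ b̂ j* q → T (adjH (b̂ j* q) (b̂ l q′))
    b̂-adj-b̂ ne = fromWitnessFalse (ne ∘ sym)

    â-i*⁻ : ∀ {p} → T (f (â i* p)) → Any (T ∘ M i* j* p) (q ∷ qa)
    â-i*⁻ t = isNeighbour-within Good S good₀ good₊ t refl
      where
      Good : V' r n → Set
      Good (â l p) = l ≡ i* → Any (T ∘ M l j* p) (q ∷ qa)
      Good _       = ⊤
      good₀ : ∀ {y} → T (adjH (b̂ j* q) y) → Good y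
      good₀ {â _ _} e _ = here e
      good₀ {b̂ _ _} _ = tt
      good₀ {c _ _} _ = tt
      good₀ {d _ _} _ = tt
      good₀ {x _ _} _ = tt
      good₊ : ∀ {z y} → z ∈ S → T (adjH z y) → Good y
      good₊ {y = b̂ _ _} _ _ = tt
      good₊ {y = c _ _} _ _ = tt
      good₊ {y = d _ _} _ _ = tt
      good₊ {y = x _ _} _ _ = tt
      good₊ {y = â l p} z∈S e with S-shape z∈S
      ... | inj₁ (l′ , _ , refl , l′≢i*) = λ l≡i* → ⊥-elim (l′≢i* (trans (toWitness e) l≡i*))
      ... | inj₂ (q′ , refl , q′∈qa)     = λ _ → there (lose q′∈qa e)

    â-i*⁺ : ∀ {p} → Any (T ∘ M i* j* p) (q ∷ qa) → T (f (â i* p))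
    â-i*⁺ {p} adj = isNeighbour⁺ S (∉S (λ ()) (λ ())) (walk adj) (λ ())
      where
      walk : Any (T ∘ M i* j* p) (q ∷ qa) → WalkThrough (_∈ S) (b̂ j* q) (â i* p)
      walk (here e) = start e
      walk (there adj′) with find adj′
      ... | q′ , q′∈qa , e with q′ ≟F q
      ...   | yes refl = start e
      ...   | no q′≢q  = step (start (b̂-adj-b̂ (q′≢q ∘ b̂-injective))) (b-done q′∈qa) e
        where
        b̂-injective : ∀ {l l′ u w} → V'.b̂ {r} {n} l u ≡ b̂ l′ w → u ≡ w
        b̂-injective refl = refl

    â-other : ∀ {l} p₀ p → l ≢ i* → T (f (â l p))
    â-other p₀ p l≢i* = isNeighbour⁺ S (∉S (λ ()) (λ ())) (step (start tt) (x-done p₀ l≢i*) (fromWitness refl)) (λ ())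

    b̂-j*⁻ : ∀ {q′} → T (f (b̂ j* q′)) → T (g (b q′))
    b̂-j*⁻ t with isNeighbour⁻ S t
    ... | b̂∉S , _ , b̂≢ = Gᵢⱼ.b-isNeighbour-b⁺ qa q (b̂∉S ∘ b-done) (b̂≢ ∘ cong (b̂ j*))

    b̂-j*⁺ : ∀ {q′} → T (g (b q′)) → T (f (b̂ j* q′))
    b̂-j*⁺ t with Gᵢⱼ.b-isNeighbour-b⁻ qa q t
    ... | q′∉qa , q′≢q = isNeighbour⁺ S (∉S (λ ()) (λ { refl → q′∉qa })) (start (b̂-adj-b̂ (λ { refl → q′≢q refl }))) (λ { refl → q′≢q refl })

    b̂-other : ∀ {l} p → l ≢ j* → T (f (b̂ l p))
    b̂-other p l≢j* = isNeighbour⁺ S (∉S (λ ()) (λ { refl → ⊥-elim (l≢j* refl) })) (start (b̂-adj-b̂ (λ { refl → l≢j* refl }))) (λ { refl → l≢j* refl })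

    c-j* : ∀ p → T (f (c j* p))
    c-j* p = isNeighbour⁺ S (∉S (λ ()) (λ ())) (start (fromWitness refl)) (λ ())

    c-other : ∀ {l} p → l ≢ j* → ¬ T (f (c l p))
    c-other p l≢j* = l≢j* ∘ c-isNeighbour-index (_≡ j*) S S-BDX (λ _ _ e → toWitness e)
      where
      S-BDX : ∀ {z} → z ∈ S → InBDX (_≡ j*) z
      S-BDX z∈S with S-shape z∈S
      ... | inj₁ (_ , _ , refl , _) = tt
      ... | inj₂ (_ , refl , _)     = refl

    d-all : ∀ l p → T (f (d l p))
    d-all l p = isNeighbour⁺ S (∉S (λ ()) (λ ())) (start tt) (λ ())

    x-i* : ∀ p → T (f (x i* p))
    x-i* p = isNeighbour⁺ S (∉S (λ { refl → refl }) (λ ())) (start tt) (λ ())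

    Σâ : Fin (n / 2) → sum (#â f) + n ≡ count (g ∘ a) + r * n
    Σâ p₀ = trans (sum-≡-except i* (λ l l≢i* → count-all {f = f ∘ â l} (λ p → â-other p₀ p l≢i*)))
                  (cong (_+ r * n) (count-⇔ {f = f ∘ â i*} {g = g ∘ a} (λ p → Gᵢⱼ.b-isNeighbour-a⁺ qa q ∘ â-i*⁻) (λ p → â-i*⁺ ∘ Gᵢⱼ.b-isNeighbour-a⁻ qa q)))

    Σb̂ : sum (#b̂ f) + n ≡ count (g ∘ b) + r * n
    Σb̂ = trans (sum-≡-except j* (λ l l≢j* → count-all {f = f ∘ b̂ l} (λ p → b̂-other p l≢j*)))
               (cong (_+ r * n) (count-⇔ {f = f ∘ b̂ j*} {g = g ∘ b} (λ p → b̂-j*⁻) (λ p → b̂-j*⁺)))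

    Σc : sum (#c f) ≡ n
    Σc = trans (sum-single j* (λ l l≢j* → count-none {f = f ∘ c l} (λ p → c-other p l≢j*))) (count-all c-j*)

    Σd : sum (#d f) ≡ r * n
    Σd = sum-≡-const (λ l → count-all (d-all l))

    Σx : sum (#x f) ≡ n / 2
    Σx = trans (sum-single i* (λ l l≢i* → count-isNeighbour-eliminated S (λ p → x-done p l≢i*))) (count-all x-i*)

    b-phase-≡ : Fin (n / 2) → 1 ≤ r →
                closedNbhdSize (after S) (b̂ j* q) ≡ (bound ∸ n) + Gᵢⱼ.closedNbhdSize (Gᵢⱼ.after (map b qa)) (b q)
    b-phase-≡ p₀ 1≤r = begin
      closedNbhdSize (after S) (b̂ j* q)
        ≡⟨ closedNbhdSize-count (after S) (b̂ j* q) ⟩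
      suc (sum (#â f) + (sum (#b̂ f) + (sum (#c f) + (sum (#d f) + sum (#x f)))))
        ≡⟨ cong (λ k → suc (sum (#â f) + (sum (#b̂ f) + k))) (cong₂ _+_ Σc (cong₂ _+_ Σd Σx)) ⟩
      suc (sum (#â f) + (sum (#b̂ f) + (n + (r * n + n / 2))))
        ≡⟨ shift-identity n (r * n) (n / 2) (Σâ p₀) Σb̂ n≤ ⟩
      (r * n + r * n + r * n + n / 2 ∸ n) + suc (count (g ∘ a) + count (g ∘ b))
        ≡⟨ cong₂ _+_ (cong (_∸ n) bound≡′) (Gᵢⱼ.closedNbhdSize-count (Gᵢⱼ.after (map b qa)) (b q)) ⟨
      (bound ∸ n) + Gᵢⱼ.closedNbhdSize (Gᵢⱼ.after (map b qa)) (b q) ∎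
      where
      open ≡-Reasoning
      bound≡′ : bound ≡ r * n + r * n + r * n + n / 2
      bound≡′ = expand r n (n / 2)
        where
        expand : ∀ r n h → 3 * r * n + h ≡ r * n + r * n + r * n + h
        expand = solve-∀
      n≤ : n ≤ r * n + r * n + r * n + n / 2
      n≤ = subst (n ≤_) bound≡′ (n≤bound 1≤r)

  module DXPhase (i* j* : Fin r) (S : List (V' r n))
      (S-BDX : ∀ {z} → z ∈ S → InBDX (_≡ j*) z)
      (b̂-done : ∀ p → b̂ j* p ∈ S)
      (x-done : ∀ {l} p → l ≢ i* → x l p ∈ S) where

    module _ (v : V' r n) (v-c : ∀ l p → T (adjH v (c l p)) → l ≡ j*) where
      private
        f = isNeighbour (after S) v

      b̂-j* : #b̂ f j* ≡ 0
      b̂-j* = count-isNeighbour-eliminated S b̂-done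

      c-other : ∀ l → l ≢ j* → #c f l ≡ 0
      c-other l l≢j* = count-none {f = f ∘ c l} (λ p → l≢j* ∘ c-isNeighbour-index (_≡ j*) S S-BDX v-c)

      weight-other : ∀ l → l ≢ j* → weight f l ≤ 3 * n
      weight-other l l≢j* = weight-≤ f l (inj₂ (c-other l l≢j*))

      weight-j* : weight f j* ≤ n + (n + #d f j*)
      weight-j* = begin
        #â f j* + (#b̂ f j* + (#c f j* + #d f j*)) ≡⟨ cong (λ k → #â f j* + (k + (#c f j* + #d f j*))) b̂-j* ⟩
        #â f j* + (#c f j* + #d f j*)             ≤⟨ +-mono-≤ (count-≤ (f ∘ â j*)) (+-monoˡ-≤ (#d f j*) (count-≤ (f ∘ c j*))) ⟩
        n + (n + #d f j*)                         ∎
        where open ≤-Reasoning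

      Σx≡ : sum (#x f) ≡ #x f i*
      Σx≡ = sum-single i* (λ l l≢i* → count-isNeighbour-eliminated S (λ p → x-done p l≢i*))

    d-phase-≤ : ∀ t → closedNbhdSize (after S) (d j* t) ≤ bound
    d-phase-≤ t = begin
      closedNbhdSize (after S) (d j* t)      ≡⟨ closedNbhdSize-weight (after S) (d j* t) ⟩
      suc (sum (weight f) + sum (#x f))      ≤⟨ +-mono-≤ (suc-sum-≤-except j* (weight-other v v-c) weight-j*<) Σx≤ ⟩
      0 + r * (3 * n) + n / 2                ≡⟨ bound≡ ⟨
      bound                                  ∎
      where
      open ≤-Reasoning
      v = d j* t
      v-c : ∀ l p → T (adjH v (c l p)) → l ≡ j*
      v-c _ _ e = sym (toWitness e)
      f = isNeighbour (after S) v
      weight-j*< : suc (weight f j*) ≤ 3 * n + 0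
      weight-j*< = begin
        suc (weight f j*)           ≤⟨ s≤s (weight-j* v v-c) ⟩
        suc (n + (n + #d f j*))     ≡⟨ trans (cong (n +_) (+-suc n (#d f j*))) (+-suc n (n + #d f j*)) ⟨
        n + (n + suc (#d f j*))     ≤⟨ +-monoʳ-≤ n (+-monoʳ-≤ n (count-isNeighbour-self S (d j*) t)) ⟩
        n + (n + n)                 ≡⟨ trans three≡ (sym (+-identityʳ _)) ⟩
        3 * n + 0                   ∎
      Σx≤ : sum (#x f) ≤ n / 2
      Σx≤ = ≤-trans (≤-reflexive (Σx≡ v v-c)) (count-≤ (f ∘ x i*))

    x*-phase-≤ : ∀ t → closedNbhdSize (after S) (x i* t) ≤ bound
    x*-phase-≤ t = begin
      closedNbhdSize (after S) (x i* t)      ≡⟨ closedNbhdSize-weight (after S) (x i* t) ⟩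
      suc (sum (weight f) + sum (#x f))      ≡⟨ +-suc (sum (weight f)) (sum (#x f)) ⟨
      sum (weight f) + suc (sum (#x f))      ≤⟨ +-mono-≤ (sum-≤-const weight-≤-3n) Σx< ⟩
      r * (3 * n) + n / 2                    ≡⟨ bound≡ ⟨
      bound                                  ∎
      where
      open ≤-Reasoning
      v = x i* t
      v-c : ∀ l p → T (adjH v (c l p)) → l ≡ j*
      v-c _ _ ()
      f = isNeighbour (after S) v
      weight-≤-3n : ∀ l → weight f l ≤ 3 * n
      weight-≤-3n l with l ≟F j*
      ... | yes refl = weight-≤ f l (inj₁ (b̂-j* v v-c))
      ... | no l≢j*  = weight-other v v-c l l≢j*
      Σx< : suc (sum (#x f)) ≤ n / 2
      Σx< = ≤-trans (s≤s (≤-reflexive (Σx≡ v v-c))) (count-isNeighbour-self S (x i*) t)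

  module BDPhase (j* : Fin r) (S : List (V' r n)) (pi : List (Fin r)) (i : Fin r) (i≢j* : i ≢ j*)
      (S-BDX : ∀ {z} → z ∈ S → InBDX (λ l → l ≡ j* ⊎ l ∈ pi ⊎ l ≡ i) z)
      (x-done : ∀ l p → x l p ∈ S)
      (j*-done : ∀ p → b̂ j* p ∈ S × d j* p ∈ S)
      (pi-done : ∀ {l} p → l ∈ pi → b̂ l p ∈ S × d l p ∈ S) where

    Allowed : Fin r → Set
    Allowed l = l ≡ j* ⊎ l ∈ pi ⊎ l ≡ i

    bd-phase-≤-core : ∀ v → let f = isNeighbour (after S) v in
      (∀ l p → T (adjH v (c l p)) → Allowed l) → suc (#b̂ f i + #d f i) ≤ n + n →
      closedNbhdSize (after S) v ≤ bound
    bd-phase-≤-core v v-c self-bd = begin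
      closedNbhdSize (after S) v             ≡⟨ closedNbhdSize-weight (after S) v ⟩
      suc (sum (weight f) + sum (#x f))      ≡⟨ cong (λ k → suc (sum (weight f) + k)) Σx≡0 ⟩
      suc (sum (weight f) + 0)               ≡⟨ cong suc (+-identityʳ _) ⟩
      suc (sum (weight f))                   ≤⟨ suc-sum-≤-except₂ i≢j* weight-other weight-i-j* ⟩
      0 + r * (3 * n)                        ≤⟨ m≤m+n (r * (3 * n)) (n / 2) ⟩
      r * (3 * n) + n / 2                    ≡⟨ bound≡ ⟨
      bound                                  ∎
      where
      open ≤-Reasoning
      f = isNeighbour (after S) v

      Σx≡0 : sum (#x f) ≡ 0
      Σx≡0 = sum-≡-0 (λ l → count-isNeighbour-eliminated S (x-done l))

      weight-j* : weight f j* ≤ n + n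
      weight-j* = begin
        #â f j* + (#b̂ f j* + (#c f j* + #d f j*))
          ≡⟨ cong₂ (λ u w → #â f j* + (u + (#c f j* + w))) (count-isNeighbour-eliminated S (proj₁ ∘ j*-done))
                                                            (count-isNeighbour-eliminated S (proj₂ ∘ j*-done)) ⟩
        #â f j* + (#c f j* + 0)
          ≡⟨ cong (#â f j* +_) (+-identityʳ _) ⟩
        #â f j* + #c f j*
          ≤⟨ +-mono-≤ (count-≤ (f ∘ â j*)) (count-≤ (f ∘ c j*)) ⟩
        n + n ∎

      weight-i-j* : suc (weight f i) + weight f j* ≤ 3 * n + 3 * n + 0
      weight-i-j* = begin
        suc (weight f i) + weight f j*
          ≡⟨ regroup (#â f i) (#b̂ f i) (#c f i) (#d f i) (weight f j*) ⟩
        #â f i + #c f i + suc (#b̂ f i + #d f i) + weight f j*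
          ≤⟨ +-mono-≤ (+-mono-≤ (+-mono-≤ (count-≤ (f ∘ â i)) (count-≤ (f ∘ c i))) self-bd) weight-j* ⟩
        n + n + (n + n) + (n + n)
          ≡⟨ regroup′ n ⟩
        3 * n + 3 * n + 0 ∎
        where
        regroup : ∀ u v w y z → suc (u + (v + (w + y))) + z ≡ u + w + suc (v + y) + z
        regroup = solve-∀
        regroup′ : ∀ m → m + m + (m + m) + (m + m) ≡ 3 * m + 3 * m + 0
        regroup′ = solve-∀

      weight-other : ∀ l → l ≢ i → l ≢ j* → weight f l ≤ 3 * n
      weight-other l l≢i l≢j* with any? (l ≟F_) pi
      ... | yes l∈pi = weight-≤ f l (inj₁ (count-isNeighbour-eliminated S (λ p → proj₁ (pi-done p l∈pi))))
      ... | no l∉pi  = weight-≤ f l (inj₂ (count-none {f = f ∘ c l} (λ p → not-allowed ∘ c-isNeighbour-index Allowed S S-BDX v-c)))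
        where
        not-allowed : ¬ Allowed l
        not-allowed (inj₁ l≡j*)         = l≢j* l≡j*
        not-allowed (inj₂ (inj₁ l∈pi))  = l∉pi l∈pi
        not-allowed (inj₂ (inj₂ l≡i))   = l≢i l≡i

    bd-phase-≤ : ∀ {v} t → v ≡ b̂ i t ⊎ v ≡ d i t → closedNbhdSize (after S) v ≤ bound
    bd-phase-≤ t (inj₁ refl) = bd-phase-≤-core (b̂ i t) (λ _ _ e → inj₂ (inj₂ (toWitness e)))
      (+-mono-≤ (count-isNeighbour-self S (b̂ i) t) (count-≤ (isNeighbour (after S) (b̂ i t) ∘ d i)))
    bd-phase-≤ t (inj₂ refl) = bd-phase-≤-core (d i t) (λ _ _ e → inj₂ (inj₂ (sym (toWitness e))))
      (≤-trans (≤-reflexive (sym (+-suc _ _))) (+-mono-≤ (count-≤ (isNeighbour (after S) (d i t) ∘ b̂ i)) (count-isNeighbour-self S (d i) t)))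

  final-phase-≤ : ∀ S v → 1 ≤ n / 2 → (∀ l p → b̂ l p ∈ S) → (∀ l p → x l p ∈ S) → closedNbhdSize (after S) v ≤ bound
  final-phase-≤ S v 1≤n/2 b̂-done x-done = begin
    closedNbhdSize (after S) v             ≡⟨ closedNbhdSize-weight (after S) v ⟩
    suc (sum (weight f) + sum (#x f))      ≡⟨ cong (λ k → suc (sum (weight f) + k)) (sum-≡-0 (λ l → count-isNeighbour-eliminated S (x-done l))) ⟩
    suc (sum (weight f) + 0)               ≡⟨ +-comm (suc (sum (weight f))) 0 ⟩
    suc (sum (weight f))                   ≡⟨ +-comm 1 (sum (weight f)) ⟩
    sum (weight f) + 1                     ≤⟨ +-mono-≤ (sum-≤-const (λ l → weight-≤ f l (inj₁ (count-isNeighbour-eliminated S (b̂-done l))))) 1≤n/2 ⟩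
    r * (3 * n) + n / 2                    ≡⟨ bound≡ ⟨
    bound                                  ∎
    where
    open ≤-Reasoning
    f = isNeighbour (after S) v

module CanonicalOrder (r n : ℕ) (M : Fin r → Fin r → Fin n → Fin n → Bool) (i* j* : Fin r)
                      {π' : List (V' r n)} (can : Canonical i* j* π') where
  open Canonical can
  open CompositeElimination r n M

  ∈-others⁻ : ∀ {l i : Fin r} → l ∈ others {n = n} i → l ≢ i
  ∈-others⁻ {l} {i} l∈ = toWitnessFalse (proj₂ (∈-filter⁻ (λ j → T? (not ⌊ j ≟F i ⌋)) {xs = allFin r} l∈))

  ∈-others⁺ : ∀ {l i : Fin r} → l ≢ i → l ∈ others {n = n} i
  ∈-others⁺ {l} {i} l≢i = ∈-filter⁺ (λ j → T? (not ⌊ j ≟F i ⌋)) (∈-allFin l) (fromWitnessFalse l≢i)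

  XB BD : List (V' r n)
  XB = concat xBlocks
  BD = concat bdBlocks

  ∈XB⁻ : ∀ {z} → z ∈ XB → ∃₂ λ l p → z ≡ x l p × l ≢ i*
  ∈XB⁻ z∈ with ∈-concat-↭⁻ xBlocks-ok z∈
  ... | l , l∈ , z∈X with ∈-map-allFin⁻ z∈X
  ...   | p , z≡ = l , p , z≡ , ∈-others⁻ (∈-resp-↭ xIdx-perm l∈)

  x∈XB : ∀ {l} p → l ≢ i* → x l p ∈ XB
  x∈XB p l≢i* = ∈-concat-↭⁺ xBlocks-ok (∈-resp-↭ (↭-sym xIdx-perm) (∈-others⁺ l≢i*)) (∈-map-allFin⁺ (x _) p)

  bdBlocks-ok′ : Pointwise (λ blk l → blk ↭ B'set l ++ D'set l) bdBlocks bdIdx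
  bdBlocks-ok′ = Pointwise.map (λ { (_ , _ , refl , bb↭ , dd↭) → ++⁺ bb↭ dd↭ }) bdBlocks-ok

  ∈B'D'⁻ : ∀ {l} {z : V' r n} → z ∈ B'set l ++ D'set l → ∃ λ t → z ≡ b̂ l t ⊎ z ≡ d l t
  ∈B'D'⁻ {l} z∈ with ∈-++⁻ (B'set l) z∈
  ... | inj₁ z∈B = let t , z≡ = ∈-map-allFin⁻ z∈B in t , inj₁ z≡
  ... | inj₂ z∈D = let t , z≡ = ∈-map-allFin⁻ z∈D in t , inj₂ z≡

  ∈BD⁻ : ∀ {z} → z ∈ BD → ∃₂ λ l p → (z ≡ b̂ l p ⊎ z ≡ d l p) × l ≢ j*
  ∈BD⁻ z∈ with ∈-concat-↭⁻ bdBlocks-ok′ z∈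
  ... | l , l∈ , z∈BD = let p , z≡ = ∈B'D'⁻ z∈BD in l , p , z≡ , ∈-others⁻ (∈-resp-↭ bdIdx-perm l∈)

  bd∈BD : ∀ {l} p → l ≢ j* → b̂ l p ∈ BD × d l p ∈ BD
  bd∈BD {l} p l≢j* = ∈-concat-↭⁺ bdBlocks-ok′ l∈ (∈-++⁺ˡ (∈-map-allFin⁺ (b̂ l) p)) ,
                     ∈-concat-↭⁺ bdBlocks-ok′ l∈ (∈-++⁺ʳ (B'set l) (∈-map-allFin⁺ (d l) p))
    where l∈ = ∈-resp-↭ (↭-sym bdIdx-perm) (∈-others⁺ l≢j*)

  ∈final⁻ : ∀ {z} → z ∈ final → (∃₂ λ l p → z ≡ â l p) ⊎ (∃₂ λ l p → z ≡ c l p)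
  ∈final⁻ z∈ with ∈-concat⁻′ (map (λ l → A'set l ++ C'set l) (allFin r)) (∈-resp-↭ final-ok z∈)
  ... | _ , z∈AC , AC∈ with ∈-map-allFin⁻ AC∈
  ...   | l , refl with ∈-++⁻ (A'set l) z∈AC
  ...     | inj₁ z∈A = let p , z≡ = ∈-map-allFin⁻ z∈A in inj₁ (l , p , z≡)
  ...     | inj₂ z∈C = let p , z≡ = ∈-map-allFin⁻ z∈C in inj₂ (l , p , z≡)

  P₂ P₃ P₄ P₅ : List (V' r n)
  P₂ = XB ++ bj
  P₃ = P₂ ++ dj
  P₄ = P₃ ++ xi
  P₅ = P₄ ++ BD

  ++-⊆ : ∀ {L L′ L″ : List (V' r n)} → L ⊆ L″ → L′ ⊆ L″ → L ++ L′ ⊆ L″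
  ++-⊆ {L} L⊆ L′⊆ z∈ = [ L⊆ , L′⊆ ]′ (∈-++⁻ L z∈)

  P₄-BDX : ∀ {z} → z ∈ P₄ → InBDX (_≡ j*) z
  P₄-BDX z∈ with ∈-++⁻ P₃ z∈
  ... | inj₂ z∈xi = case-x (∈-segment⁻ xi-ok z∈xi)
    where case-x : ∀ {z} → (∃ λ p → z ≡ x i* p) → InBDX (_≡ j*) z
          case-x (_ , refl) = tt
  ... | inj₁ z∈P₃ with ∈-++⁻ P₂ z∈P₃
  ...   | inj₂ z∈dj = case-d (∈-segment⁻ dj-ok z∈dj)
    where case-d : ∀ {z} → (∃ λ p → z ≡ d j* p) → InBDX (_≡ j*) z
          case-d (_ , refl) = refl
  ...   | inj₁ z∈P₂ with ∈-++⁻ XB z∈P₂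
  ...     | inj₂ z∈bj = case-b̂ (∈-segment⁻ bj-ok z∈bj)
    where case-b̂ : ∀ {z} → (∃ λ p → z ≡ b̂ j* p) → InBDX (_≡ j*) z
          case-b̂ (_ , refl) = refl
  ...     | inj₁ z∈XB = case-x′ (∈XB⁻ z∈XB)
    where case-x′ : ∀ {z} → (∃₂ λ l p → z ≡ x l p × l ≢ i*) → InBDX (_≡ j*) z
          case-x′ (_ , _ , refl , _) = tt

  x∈P₄ : ∀ l p → x l p ∈ P₄
  x∈P₄ l p with l ≟F i*
  ... | yes refl = ∈-++⁺ʳ P₃ (∈-segment⁺ xi-ok p)
  ... | no l≢i*  = ∈-++⁺ˡ (∈-++⁺ˡ (∈-++⁺ˡ (x∈XB p l≢i*)))

  b̂∈P₂ : ∀ p → b̂ j* p ∈ P₂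
  b̂∈P₂ p = ∈-++⁺ʳ XB (∈-segment⁺ bj-ok p)

  d∈P₄ : ∀ p → d j* p ∈ P₄
  d∈P₄ p = ∈-++⁺ˡ (∈-++⁺ʳ P₂ (∈-segment⁺ dj-ok p))

  XB-≤ : costFrom initial XB ≤ bound
  XB-≤ = costFrom-concat-≤ initial xBlocks-ok (All.universal (λ _ → tt) xIdx) block-≤
    where
    block-≤ : ∀ {pb pi} → Pointwise (λ blk l → blk ↭ X'set l) pb pi → ∀ {blk l} → blk ↭ X'set l → ⊤ →
              costFrom (after (concat pb)) blk ≤ bound
    block-≤ {pb} {pi} pb-ok {blk} {l} blk↭ _ = costFrom-run-≤ initial (concat pb) blk vertex-≤
      where
      vertex-≤ : ∀ L₁ {v} → L₁ ⊆ blk → v ∈ blk → closedNbhdSize (after (concat pb ++ L₁)) v ≤ bound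
      vertex-≤ L₁ L₁⊆ v∈ with ∈-segment⁻ blk↭ v∈
      ... | t , refl = XPhase.x-phase-≤ (concat pb ++ L₁) pi l t S-x
                         (λ p l′∈pi → ∈-++⁺ˡ (∈-concat-↭⁺ pb-ok l′∈pi (∈-map-allFin⁺ (x _) p)))
        where
        S-x : ∀ {z} → z ∈ concat pb ++ L₁ → ∃₂ λ l′ p → z ≡ x l′ p × (l′ ∈ pi ⊎ l′ ≡ l)
        S-x z∈ with ∈-++⁻ (concat pb) z∈
        ... | inj₁ z∈pb with ∈-concat-↭⁻ pb-ok z∈pb
        ...   | l′ , l′∈pi , z∈X = let p , z≡ = ∈-map-allFin⁻ z∈X in l′ , p , z≡ , inj₁ l′∈pi
        S-x z∈ | inj₂ z∈L₁ = let p , z≡ = ∈-segment⁻ blk↭ (L₁⊆ z∈L₁) in l , p , z≡ , inj₂ refl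

  dj-≤ : costFrom (after P₂) dj ≤ bound
  dj-≤ = costFrom-run-≤ initial P₂ dj vertex-≤
    where
    vertex-≤ : ∀ L₁ {v} → L₁ ⊆ dj → v ∈ dj → closedNbhdSize (after (P₂ ++ L₁)) v ≤ bound
    vertex-≤ L₁ L₁⊆ v∈ with ∈-segment⁻ dj-ok v∈
    ... | t , refl = DXPhase.d-phase-≤ i* j* (P₂ ++ L₁)
                       (P₄-BDX ∘ ++-⊆ (∈-++⁺ˡ ∘ ∈-++⁺ˡ) (∈-++⁺ˡ ∘ ∈-++⁺ʳ P₂ ∘ L₁⊆))
                       (∈-++⁺ˡ ∘ b̂∈P₂) (λ p l≢i* → ∈-++⁺ˡ (∈-++⁺ˡ (x∈XB p l≢i*))) t

  xi-≤ : costFrom (after P₃) xi ≤ bound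
  xi-≤ = costFrom-run-≤ initial P₃ xi vertex-≤
    where
    vertex-≤ : ∀ L₁ {v} → L₁ ⊆ xi → v ∈ xi → closedNbhdSize (after (P₃ ++ L₁)) v ≤ bound
    vertex-≤ L₁ L₁⊆ v∈ with ∈-segment⁻ xi-ok v∈
    ... | t , refl = DXPhase.x*-phase-≤ i* j* (P₃ ++ L₁)
                       (P₄-BDX ∘ ++-⊆ ∈-++⁺ˡ (∈-++⁺ʳ P₃ ∘ L₁⊆))
                       (λ p → ∈-++⁺ˡ (∈-++⁺ˡ (b̂∈P₂ p))) (λ p l≢i* → ∈-++⁺ˡ (∈-++⁺ˡ (∈-++⁺ˡ (x∈XB p l≢i*)))) t

  BD-≤ : costFrom (after P₄) BD ≤ bound
  BD-≤ = costFrom-concat-≤ (after P₄) bdBlocks-ok′ (All.tabulate (λ l∈ → ∈-others⁻ (∈-resp-↭ bdIdx-perm l∈))) block-≤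
    where
    block-≤ : ∀ {pb pi} → Pointwise (λ blk l → blk ↭ B'set l ++ D'set l) pb pi → ∀ {blk i} → blk ↭ B'set i ++ D'set i →
              i ≢ j* → costFrom (run (after P₄) (concat pb)) blk ≤ bound
    block-≤ {pb} {pi} pb-ok {blk} {i} blk↭ i≢j* =
      subst (λ st → costFrom st blk ≤ bound) (run-++ initial P₄ (concat pb)) (costFrom-run-≤ initial (P₄ ++ concat pb) blk vertex-≤)
      where
      Allowed : Fin r → Set
      Allowed l = l ≡ j* ⊎ l ∈ pi ⊎ l ≡ i
      B'D'-BDX : ∀ {l} {z : V' r n} → (∃ λ t → z ≡ b̂ l t ⊎ z ≡ d l t) → InBDX (_≡ l) z
      B'D'-BDX (_ , inj₁ refl) = refl
      B'D'-BDX (_ , inj₂ refl) = refl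
      InBDX-map : ∀ {P Q : Fin r → Set} → (∀ {l} → P l → Q l) → ∀ z → InBDX P z → InBDX Q z
      InBDX-map f (b̂ _ _) = f
      InBDX-map f (d _ _) = f
      InBDX-map f (x _ _) = _
      vertex-≤ : ∀ L₁ {v} → L₁ ⊆ blk → v ∈ blk → closedNbhdSize (after ((P₄ ++ concat pb) ++ L₁)) v ≤ bound
      vertex-≤ L₁ L₁⊆ v∈ = BDPhase.bd-phase-≤ j* ((P₄ ++ concat pb) ++ L₁) pi i i≢j* S-BDX
                         (λ l p → ∈-++⁺ˡ (∈-++⁺ˡ (x∈P₄ l p)))
                         (λ p → ∈-++⁺ˡ (∈-++⁺ˡ (∈-++⁺ˡ (∈-++⁺ˡ (b̂∈P₂ p)))) , ∈-++⁺ˡ (∈-++⁺ˡ (d∈P₄ p)))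
                         (λ p l∈pi → ∈-++⁺ˡ (∈-++⁺ʳ P₄ (∈-concat-↭⁺ pb-ok l∈pi (∈-++⁺ˡ (∈-map-allFin⁺ (b̂ _) p)))) ,
                                     ∈-++⁺ˡ (∈-++⁺ʳ P₄ (∈-concat-↭⁺ pb-ok l∈pi (∈-++⁺ʳ (B'set _) (∈-map-allFin⁺ (d _) p)))))
                         (proj₁ v≡) (proj₂ v≡)
        where
        v≡ = ∈B'D'⁻ (∈-resp-↭ blk↭ v∈)
        S-BDX : ∀ {z} → z ∈ (P₄ ++ concat pb) ++ L₁ → InBDX Allowed z
        S-BDX {z} z∈ with ∈-++⁻ (P₄ ++ concat pb) z∈
        ... | inj₂ z∈L₁ = InBDX-map {_≡ i} {Allowed} (λ { refl → inj₂ (inj₂ refl) }) z (B'D'-BDX (∈B'D'⁻ (∈-resp-↭ blk↭ (L₁⊆ z∈L₁))))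
        ... | inj₁ z∈P with ∈-++⁻ P₄ z∈P
        ...   | inj₁ z∈P₄ = InBDX-map {_≡ j*} {Allowed} inj₁ z (P₄-BDX z∈P₄)
        ...   | inj₂ z∈pb with ∈-concat-↭⁻ pb-ok z∈pb
        ...     | l , l∈pi , z∈BDl = InBDX-map {_≡ l} {Allowed} (λ { refl → inj₂ (inj₁ l∈pi) }) z (B'D'-BDX (∈B'D'⁻ z∈BDl))

  b̂∈P₅ : ∀ l p → b̂ l p ∈ P₅
  b̂∈P₅ l p with l ≟F j*
  ... | yes refl = ∈-++⁺ˡ (∈-++⁺ˡ (∈-++⁺ˡ (b̂∈P₂ p)))
  ... | no l≢j*  = ∈-++⁺ʳ P₄ (proj₁ (bd∈BD p l≢j*))

  final-≤ : 1 ≤ n / 2 → costFrom (after P₅) final ≤ bound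
  final-≤ 1≤n/2 = costFrom-run-≤ initial P₅ final (λ L₁ {v} _ _ →
    final-phase-≤ (P₅ ++ L₁) v 1≤n/2 (λ l p → ∈-++⁺ˡ (b̂∈P₅ l p)) (λ l p → ∈-++⁺ˡ (∈-++⁺ˡ (x∈P₄ l p))))

  c-XB c-bj c-dj c-xi c-BD c-final : ℕ
  c-XB    = costFrom initial XB
  c-bj    = costFrom (after XB) bj
  c-dj    = costFrom (after P₂) dj
  c-xi    = costFrom (after P₃) xi
  c-BD    = costFrom (after P₄) BD
  c-final = costFrom (after P₅) final

  cost-segments : cost H π' ≡ c-XB ⊔ (c-bj ⊔ (c-dj ⊔ (c-xi ⊔ (c-BD ⊔ c-final))))
  cost-segments = begin
    costFrom initial π'
      ≡⟨ cong (costFrom initial) shape ⟩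
    costFrom initial (XB ++ bj ++ dj ++ xi ++ BD ++ final)
      ≡⟨ costFrom-after-++ [] XB _ ⟩
    c-XB ⊔ costFrom (after XB) (bj ++ dj ++ xi ++ BD ++ final)
      ≡⟨ cong (c-XB ⊔_) (costFrom-after-++ XB bj _) ⟩
    c-XB ⊔ (c-bj ⊔ costFrom (after P₂) (dj ++ xi ++ BD ++ final))
      ≡⟨ cong (λ k → c-XB ⊔ (c-bj ⊔ k)) (costFrom-after-++ P₂ dj _) ⟩
    c-XB ⊔ (c-bj ⊔ (c-dj ⊔ costFrom (after P₃) (xi ++ BD ++ final)))
      ≡⟨ cong (λ k → c-XB ⊔ (c-bj ⊔ (c-dj ⊔ k))) (costFrom-after-++ P₃ xi _) ⟩
    c-XB ⊔ (c-bj ⊔ (c-dj ⊔ (c-xi ⊔ costFrom (after P₄) (BD ++ final))))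
      ≡⟨ cong (λ k → c-XB ⊔ (c-bj ⊔ (c-dj ⊔ (c-xi ⊔ k)))) (costFrom-after-++ P₄ BD final) ⟩
    c-XB ⊔ (c-bj ⊔ (c-dj ⊔ (c-xi ⊔ (c-BD ⊔ c-final)))) ∎
    where open ≡-Reasoning

  projB̂-b̂ : ∀ q → projB̂ {r} {n} j* (b̂ j* q) ≡ just q
  projB̂-b̂ q with j* ≟F j*
  ... | yes _    = refl
  ... | no j*≢j* = ⊥-elim (j*≢j* refl)

  projB̂-other : ∀ {l} q → l ≢ j* → projB̂ {r} {n} j* (b̂ l q) ≡ nothing
  projB̂-other {l} q l≢j* with l ≟F j*
  ... | yes l≡j* = ⊥-elim (l≢j* l≡j*)
  ... | no _     = refl

  bj-retract : bj ≡ map (b̂ j*) (mapMaybe (projB̂ j*) bj)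
  bj-retract = map-mapMaybe-retract (projB̂ j*) (b̂ j*) bj (λ y∈ → retract (∈-segment⁻ bj-ok y∈))
    where
    retract : ∀ {y} → (∃ λ q → y ≡ b̂ j* q) → ∃ λ q → y ≡ b̂ j* q × projB̂ j* y ≡ just q
    retract (q , refl) = q , refl , projB̂-b̂ q

  mapMaybe-π′ : mapMaybe (projB̂ j*) π' ≡ mapMaybe (projB̂ j*) bj
  mapMaybe-π′ = begin
    mapMaybe (projB̂ j*) π'
      ≡⟨ cong (mapMaybe (projB̂ j*)) shape ⟩
    mapMaybe (projB̂ j*) (XB ++ bj ++ later)
      ≡⟨ mapMaybe-++ (projB̂ j*) XB (bj ++ later) ⟩
    mapMaybe (projB̂ j*) XB ++ mapMaybe (projB̂ j*) (bj ++ later)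
      ≡⟨ cong₂ _++_ (mapMaybe-nothing-∈ (projB̂ j*) XB XB-nothing) (mapMaybe-++ (projB̂ j*) bj later) ⟩
    mapMaybe (projB̂ j*) bj ++ mapMaybe (projB̂ j*) later
      ≡⟨ cong (mapMaybe (projB̂ j*) bj ++_) (mapMaybe-nothing-∈ (projB̂ j*) later later-nothing) ⟩
    mapMaybe (projB̂ j*) bj ++ []
      ≡⟨ ++-identityʳ _ ⟩
    mapMaybe (projB̂ j*) bj ∎
    where
    open ≡-Reasoning
    later : List (V' r n)
    later = dj ++ xi ++ BD ++ final
    XB-nothing : ∀ {y} → y ∈ XB → projB̂ j* y ≡ nothing
    XB-nothing y∈ with ∈XB⁻ y∈
    ... | _ , _ , refl , _ = refl
    later-nothing : ∀ {y} → y ∈ later → projB̂ j* y ≡ nothing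
    later-nothing y∈ with ∈-++⁻ dj y∈
    ... | inj₁ y∈dj with ∈-segment⁻ dj-ok y∈dj
    ...   | _ , refl = refl
    later-nothing y∈ | inj₂ y∈′ with ∈-++⁻ xi y∈′
    ... | inj₁ y∈xi with ∈-segment⁻ xi-ok y∈xi
    ...   | _ , refl = refl
    later-nothing y∈ | inj₂ y∈′ | inj₂ y∈″ with ∈-++⁻ BD y∈″
    ... | inj₁ y∈BD with ∈BD⁻ y∈BD
    ...   | _ , q , inj₁ refl , l≢j* = projB̂-other q l≢j*
    ...   | _ , _ , inj₂ refl , _    = refl
    later-nothing y∈ | inj₂ y∈′ | inj₂ y∈″ | inj₂ y∈final with ∈final⁻ y∈final
    ... | inj₁ (_ , _ , refl) = refl
    ... | inj₂ (_ , _ , refl) = refl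

  module Gᵢⱼ = CobipartiteElimination n (M i* j*)

  module _ (1≤r : 1 ≤ r) (0<n : 0 < n) (1≤n/2 : 1 ≤ n / 2) {π : List (CBV n)}
           (split : Gᵢⱼ.BFirstSplit π) (agree : AgreeOnB j* π' π) where
    open Gᵢⱼ.BFirstSplit split

    K : ℕ
    K = bound ∸ n

    bj≡ : bj ≡ map (b̂ j*) bs
    bj≡ = trans bj-retract (cong (map (b̂ j*)) (trans (sym mapMaybe-π′) (trans agree (Gᵢⱼ.mapMaybe-projB split))))

    c-bj-shift : c-bj ⊔ K ≡ K + Gᵢⱼ.costFrom Gᵢⱼ.initial (map b bs)
    c-bj-shift = subst (λ seg → costFrom (after XB) seg ⊔ K ≡ K + Gᵢⱼ.costFrom Gᵢⱼ.initial (map b bs)) (sym bj≡)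
                       (costFrom-shift H Gᵢⱼ.G (b̂ j*) b K (after XB) Gᵢⱼ.initial bs vertex-≡)
      where
      vertex-≡ : ∀ qa q qb → bs ≡ qa ++ q ∷ qb →
        closedNbhdSize (run (after XB) (map (b̂ j*) qa)) (b̂ j* q) ≡ K + Gᵢⱼ.closedNbhdSize (Gᵢⱼ.after (map b qa)) (b q)
      vertex-≡ qa q _ _ = subst (λ st → closedNbhdSize st (b̂ j* q) ≡ K + Gᵢⱼ.closedNbhdSize (Gᵢⱼ.after (map b qa)) (b q))
        (run-++ initial XB (map (b̂ j*) qa))
        (BPhase.b-phase-≡ i* j* (XB ++ map (b̂ j*) qa) qa q S-shape (λ p l≢i* → ∈-++⁺ˡ (x∈XB p l≢i*)) (∈-++⁺ʳ XB ∘ ∈-map⁺ (b̂ j*)) (fromℕ< 1≤n/2) 1≤r)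
        where
        S-shape : ∀ {z} → z ∈ XB ++ map (b̂ j*) qa → (∃₂ λ l p → z ≡ x l p × l ≢ i*) ⊎ (∃ λ q′ → z ≡ b̂ j* q′ × q′ ∈ qa)
        S-shape z∈ with ∈-++⁻ XB z∈
        ... | inj₁ z∈XB = inj₁ (∈XB⁻ z∈XB)
        ... | inj₂ z∈qa = let q′ , q′∈qa , z≡ = ∈-map⁻ (b̂ j*) z∈qa in inj₂ (q′ , z≡ , q′∈qa)

    c-bj≡ : c-bj ≡ K + cost Gᵢⱼ.G π
    c-bj≡ = ⊔-≡-+ (trans c-bj-shift (cong (K +_) (sym (Gᵢⱼ.cost-B-first split q₀))))
                  (≤-trans 0<n (≤-trans (Gᵢⱼ.costFrom-B-≥ split q₀) (≤-reflexive (sym (Gᵢⱼ.cost-B-first split q₀)))))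
      where q₀ = fromℕ< 0<n

    bound≤c-bj : bound ≤ c-bj
    bound≤c-bj = begin
      bound                 ≡⟨ m∸n+n≡m (n≤bound 1≤r) ⟨
      K + n                 ≤⟨ +-monoʳ-≤ K (Gᵢⱼ.costFrom-B-≥ split (fromℕ< 0<n)) ⟩
      K + Gᵢⱼ.costFrom Gᵢⱼ.initial (map b bs) ≡⟨ cong (K +_) (Gᵢⱼ.cost-B-first split (fromℕ< 0<n)) ⟨
      K + cost Gᵢⱼ.G π      ≡⟨ c-bj≡ ⟨
      c-bj                  ∎
      where open ≤-Reasoning

    cost-canonical : cost H π' ≡ K + cost Gᵢⱼ.G π
    cost-canonical = begin
      cost H π'                                                        ≡⟨ cost-segments ⟩
      c-XB ⊔ (c-bj ⊔ (c-dj ⊔ (c-xi ⊔ (c-BD ⊔ c-final))))               ≡⟨ ⊔-peak (below XB-≤) (⊔-lub (below dj-≤) (⊔-lub (below xi-≤) (⊔-lub (below BD-≤) (below (final-≤ 1≤n/2))))) ⟩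
      c-bj                                                             ≡⟨ c-bj≡ ⟩
      K + cost Gᵢⱼ.G π                                                 ∎
      where
      open ≡-Reasoning
      below : ∀ {k} → k ≤ bound → k ≤ c-bj
      below k≤ = ≤-trans k≤ bound≤c-bj

lemma4 : (r n k : ℕ) → 1 ≤ r → 0 < n → 2 ∣ n → 0 < k → k < n / 2 →
         (M : Fin r → Fin r → Fin n → Fin n → Bool) →
         ((i j : Fin r) → HasPerfectMatching n (M i j)) →
         (i* j* : Fin r) →
         (π' : List (V' r n)) → Canonical i* j* π' →
         (π : List (CBV n)) → EliminationOrder (cobipartite n (M i* j*)) π →
         ((p q : Fin n) → Before π (b q) (a p)) →
         AgreeOnB j* π' π →
         cost (G' r n M) π' ≡ (3 * r * n + n / 2) ∸ n + cost (cobipartite n (M i* j*)) π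
lemma4 r n k 1≤r 0<n _ 0<k k<n/2 M _ i* j* π' canonical π π↭ b-before-a agree =
  CanonicalOrder.cost-canonical r n M i* j* canonical 1≤r 0<n (<-trans 0<k k<n/2)
    (CobipartiteElimination.bFirstSplit n (M i* j*) π↭ b-before-a) agree
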